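{- Let $N\in\mathbb{Z}_{\geq2}$ be square-free. The negative Pell equation $x^2-Ny^2=-1$ has integer solutions $x,y$ if and only if $\mathbb{Q}(\sqrt{N})\neq\mathbb{Q}(\sqrt{(\kappa n)^2-4\kappa})$ for all square-free $\kappa\in\mathbb{Z}_{\geq2}$ and all $n\in\mathbb{Z}_{\geq1}$ such that $\kappa n^2-4$ is not a perfect square. -}

module Defs where

open import Data.Nat using (ℕ; _*_)
open import Data.Nat.Divisibility using (_∣_)
open import Data.Integer as ℤ using (ℤ; +_; -[1+_])
open import Data.Product using (∃; ∃-syntax; _×_)
open import Relation.Binary.PropositionalEquality using (_≡_; _≢_)

SquareFree : ℕ → Set
SquareFree n = ∀ (d : ℕ) → (d * d) ∣ n → d ≡ 1

IsSquare : ℤ → Set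
IsSquare z = ∃[ m ] z ≡ m ℤ.* m

NegPellSolvable : ℕ → Set
NegPellSolvable N = ∃[ x ] ∃[ y ] (x ℤ.* x ℤ.- (+ N) ℤ.* (y ℤ.* y) ≡ -[1+ 0 ])

-- Q(√a) = Q(√b) for nonzero integers a, b: the square classes agree,
-- i.e. a = b·(p/q)² for some nonzero rational p/q, written integrally
-- as a·q² = b·p² with p, q ≠ 0 (Kummer theory for quadratic extensions).
SameQuadField : ℤ → ℤ → Set
SameQuadField a b = ∃[ p ] ∃[ q ] (p ≢ ℤ.0ℤ × q ≢ ℤ.0ℤ × a ℤ.* (q ℤ.* q) ≡ b ℤ.* (p ℤ.* p))

module Submission where

-- Units of norm ±1 of the ring of integers of ℚ(√N) are written (a + b √N)/2 with a² − N b² = ±4.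
--
-- (⇐) The continued fraction of √N is purely periodic, which yields a solution of
-- a² − N b² = ±1 with b ≥ 1.  Given a² − N b² = 1, N b² = (a − 1)(a + 1): if 2(a − 1) is a
-- square the equation x² − N y² = −1 is solvable; if 2(a + 1) is a square, a smaller
-- solution of x² − N y² = 1 exists; otherwise 2(a + 1) = κ m² with κ ≥ 2 square-free,
-- κ m² − 4 = 2(a − 1) is not a square, and N (2b)² = ((κ m)² − 4κ) m².
--
-- (⇒) If x² − N y² = −1 is solvable, let η be the unit of norm −1 with the least b.
-- Descending by η² shows that every unit ε of norm 1 is a square φ², and then
-- a + 2 or a − 2 equals (φ ± φ̄)², a perfect square.  The unit ((κ n² − 2) + n t √N)/2,
-- where (κ n)² − 4κ = N t², has a + 2 = κ n², not a square since κ ≠ 1 is square-free,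
-- and a − 2 = κ n² − 4, not a square by hypothesis.

open import Data.Nat as ℕ using (ℕ; _≤_)
open import Data.Integer as ℤ using (+_)
open import Data.Empty using (⊥-elim)
open import Data.Product using (∃-syntax; ∃₂; _×_; _,_)
open import Data.Sum using (_⊎_; inj₁; inj₂; [_,_]′)
open import Function using (id)
open import Function.Bundles using (_⇔_; mk⇔)
open import Relation.Nullary using (¬_)
open import Defs

module Arithmetic where

  open import Data.Nat
  open import Data.Nat.Properties
  open import Data.Nat.Divisibility
  open import Data.Nat.GCD using (gcd; gcd[m,n]∣m; gcd[m,n]∣n; gcd[m,n]≢0)
  open import Data.Nat.Coprimality using (Coprime; coprime-/gcd; coprime-divisor)
  open import Data.Nat.DivMod using (_/_; m/n*n≡m)
  open import Data.Nat.Induction using (<-rec)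
  open import Data.Nat.Primality using (prime[2]; euclidsLemma)
  open import Data.Nat.Tactic.RingSolver using (solve)
  open import Data.List using (_∷_; [])
  open import Relation.Binary.PropositionalEquality
  open import Relation.Nullary using (yes; no; contradiction)
  open import Relation.Nullary.Decidable using (_×-dec_)
  open import Relation.Unary using (Decidable)

  minimal-witness : ∀ {P : ℕ → Set} → Decidable P → ∀ {n} → P n →
                    ∃[ m ] P m × (∀ {k} → k < m → ¬ P k)
  minimal-witness {P} P? {n} = <-rec (λ n → P n → ∃[ m ] P m × (∀ {k} → k < m → ¬ P k)) least n
    where
    least : ∀ n → (∀ {k} → k < n → P k → ∃[ m ] P m × (∀ {j} → j < m → ¬ P j)) →
            P n → ∃[ m ] P m × (∀ {j} → j < m → ¬ P j)
    least n smaller Pn with anyUpTo? P? n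
    ... | yes (k , k<n , Pk) = smaller k<n Pk
    ... | no none = n , Pn , λ k<n Pk → none (_ , k<n , Pk)

  square? : Decidable (λ x → ∃[ s ] x ≡ s * s)
  square? x with anyUpTo? (λ s → x ≟ s * s) (suc x)
  ... | yes (s , _ , x≡s²) = yes (s , x≡s²)
  ... | no none = no λ (s , x≡s²) → none (s , s≤s (root-bound s x≡s²) , x≡s²)
    where
    root-bound : ∀ s → x ≡ s * s → s ≤ x
    root-bound zero    _    = z≤n
    root-bound (suc s) refl = m≤m*n (suc s) (suc s)

  2∣square⇒2∣ : ∀ s → 2 ∣ s * s → 2 ∣ s
  2∣square⇒2∣ s 2∣s² = [ id , id ]′ (euclidsLemma s s prime[2] 2∣s²)

  square-cancel-< : ∀ {m n} → m * m < n * n → m < n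
  square-cancel-< {m} {n} m²<n² with m <? n
  ... | yes m<n = m<n
  ... | no m≮n = contradiction (*-mono-≤ (≮⇒≥ m≮n) (≮⇒≥ m≮n)) (<⇒≱ m²<n²)

  square-cancel-≤ : ∀ {m n} → m * m ≤ n * n → m ≤ n
  square-cancel-≤ {m} {n} m²≤n² with n <? m
  ... | yes n<m = contradiction m²≤n² (<⇒≱ (*-mono-< n<m n<m))
  ... | no n≮m = ≮⇒≥ n≮m

  square-injective : ∀ {m n} → m * m ≡ n * n → m ≡ n
  square-injective m²≡n² = ≤-antisym (square-cancel-≤ (≤-reflexive m²≡n²))
                                     (square-cancel-≤ (≤-reflexive (sym m²≡n²)))

  coprime-decomposition : ∀ c b → c ≢ 0 →
    ∃₂ λ c' b' → ∃[ g ] g ≢ 0 × c ≡ c' * g × b ≡ b' * g × Coprime c' b'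
  coprime-decomposition c b c≢0 =
    c / g , b / g , g , g≢0 ,
    sym (m/n*n≡m (gcd[m,n]∣m c b)) , sym (m/n*n≡m (gcd[m,n]∣n c b)) , coprime-/gcd c b
    where
    g : ℕ
    g = gcd c b
    g≢0 : g ≢ 0
    g≢0 = gcd[m,n]≢0 c b (inj₁ c≢0)
    instance
      _ : NonZero g
      _ = ≢-nonZero g≢0

  -- c ∣ N b² with c coprime to b gives c ∣ N, and then c² ∣ N.
  coprime-squarefree-ratio : ∀ {N b c w} → SquareFree N → Coprime c b → c ≢ 0 →
                             N * (b * b) ≡ c * (c * w) → c ≡ 1
  coprime-squarefree-ratio {N} {b} {c} {w} sfN cop c≢0 eq with c∣N
    where
    c∣N : c ∣ N
    c∣N = coprime-divisor cop (coprime-divisor cop (divides (c * w) (begin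
      b * (b * N) ≡⟨ solve (b ∷ N ∷ []) ⟩
      N * (b * b) ≡⟨ eq ⟩
      c * (c * w) ≡⟨ *-comm c (c * w) ⟩
      c * w * c   ∎)))
      where open ≡-Reasoning
  ... | divides k refl = sfN c (*-monoˡ-∣ c c∣k)
    where
    instance
      _ : NonZero c
      _ = ≢-nonZero c≢0
    cw≡kb² : c * w ≡ k * (b * b)
    cw≡kb² = *-cancelˡ-≡ _ _ c (begin
      c * (c * w)       ≡⟨ sym eq ⟩
      k * c * (b * b)   ≡⟨ solve (k ∷ c ∷ b ∷ []) ⟩
      c * (k * (b * b)) ∎)
      where open ≡-Reasoning
    c∣k : c ∣ k
    c∣k = coprime-divisor cop (coprime-divisor cop (divides w (begin
      b * (b * k)   ≡⟨ solve (b ∷ k ∷ []) ⟩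
      k * (b * b)   ≡⟨ sym cw≡kb² ⟩
      c * w         ≡⟨ *-comm c w ⟩
      w * c         ∎)))
      where open ≡-Reasoning

  squarefree-ratio : ∀ {N b c w} → SquareFree N → c ≢ 0 →
                     N * (b * b) ≡ (c * c) * w → ∃[ v ] b ≡ c * v × w ≡ N * (v * v)
  squarefree-ratio {N} {b} {c} {w} sfN c≢0 eq with coprime-decomposition c b c≢0
  ... | c' , b' , g , g≢0 , refl , refl , cop = b' , b≡cb' , w≡Nb'²
    where
    instance
      _ : NonZero g
      _ = ≢-nonZero g≢0
      _ : NonZero (g * g)
      _ = m*n≢0 g g
    reduced : N * (b' * b') ≡ c' * (c' * w)
    reduced = *-cancelʳ-≡ _ _ (g * g) (begin
      N * (b' * b') * (g * g)   ≡⟨ solve (N ∷ b' ∷ g ∷ []) ⟩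
      N * ((b' * g) * (b' * g)) ≡⟨ eq ⟩
      ((c' * g) * (c' * g)) * w ≡⟨ solve (c' ∷ g ∷ w ∷ []) ⟩
      c' * (c' * w) * (g * g)   ∎)
      where open ≡-Reasoning
    c'≡1 : c' ≡ 1
    c'≡1 = coprime-squarefree-ratio sfN cop (λ c'≡0 → c≢0 (cong (_* g) c'≡0)) reduced
    b≡cb' : b' * g ≡ c' * g * b'
    b≡cb' = trans (*-comm b' g) (sym (trans (cong (λ x → x * g * b') c'≡1) (cong (_* b') (*-identityˡ g))))
    w≡Nb'² : w ≡ N * (b' * b')
    w≡Nb'² = sym (trans reduced (trans (cong (λ x → x * (x * w)) c'≡1) (trans (*-identityˡ (1 * w)) (*-identityˡ w))))

  squarefree⇒≢0 : ∀ {n} → SquareFree n → n ≢ 0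
  squarefree⇒≢0 sf refl with sf 2 (divides 0 refl)
  ... | ()

  squarefree-times-square : ∀ {κ n s} → SquareFree κ → n ≢ 0 → κ * (n * n) ≡ s * s → κ ≡ 1
  squarefree-times-square {κ} {n} {s} sfκ n≢0 eq with squarefree-ratio {b = n} sfκ s≢0 (trans eq (sym (*-identityʳ (s * s))))
    where
    s≢0 : s ≢ 0
    s≢0 refl with m*n≡0⇒m≡0∨n≡0 κ eq
    ... | inj₁ κ≡0 = squarefree⇒≢0 sfκ κ≡0
    ... | inj₂ n²≡0 = n≢0 ([ id , id ]′ (m*n≡0⇒m≡0∨n≡0 n n²≡0))
  ... | v , _ , 1≡κv² = m*n≡1⇒m≡1 κ (v * v) (sym 1≡κv²)

  squarefree-part : ∀ n → n ≢ 0 → ∃₂ λ κ m → SquareFree κ × n ≡ κ * (m * m)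
  squarefree-part = <-rec (λ n → n ≢ 0 → ∃₂ λ κ m → SquareFree κ × n ≡ κ * (m * m)) split
    where
    split : ∀ n → (∀ {q} → q < n → q ≢ 0 → ∃₂ λ κ m → SquareFree κ × q ≡ κ * (m * m)) →
            n ≢ 0 → ∃₂ λ κ m → SquareFree κ × n ≡ κ * (m * m)
    split n smaller n≢0 with anyUpTo? (λ d → 2 ≤? d ×-dec d * d ∣? n) (suc n)
    ... | no none = n , 1 , squarefree , sym (*-identityʳ n)
      where
      instance
        _ : NonZero n
        _ = ≢-nonZero n≢0
      squarefree : SquareFree n
      squarefree zero          d²∣n = contradiction (0∣⇒≡0 d²∣n) n≢0
      squarefree (suc zero)    _    = refl
      squarefree d@(suc (suc _)) d²∣n =
        contradiction (d , s≤s (≤-trans (m≤m*n d d) (∣⇒≤ d²∣n)) , s≤s (s≤s z≤n) , d²∣n) none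
    ... | yes (d , _ , 2≤d , divides q n≡qd²) with smaller q<n q≢0
      where
      q≢0 : q ≢ 0
      q≢0 refl = n≢0 n≡qd²
      q<n : q < n
      q<n = subst (q <_) (sym n≡qd²)
              (m<m*n q (d * d) {{≢-nonZero q≢0}} (≤-trans (s≤s (s≤s z≤n)) (*-mono-≤ 2≤d 2≤d)))
    ... | κ , m , sfκ , q≡κm² = κ , m * d , sfκ , (begin
      n                     ≡⟨ n≡qd² ⟩
      q * (d * d)           ≡⟨ cong (_* (d * d)) q≡κm² ⟩
      κ * (m * m) * (d * d) ≡⟨ solve (κ ∷ m ∷ d ∷ []) ⟩
      κ * ((m * d) * (m * d)) ∎)
      where open ≡-Reasoning

  half-square : ∀ {x s} → 2 * x ≡ s * s → ∃[ w ] x ≡ 2 * (w * w)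
  half-square {x} {s} 2x≡s² with 2∣square⇒2∣ s (divides x (trans (sym 2x≡s²) (*-comm 2 x)))
  ... | divides w refl = w , *-cancelˡ-≡ x (2 * (w * w)) 2 (trans 2x≡s² (solve (w ∷ [])))

  *-square≢0 : ∀ {N b} → N ≢ 0 → 1 ≤ b → N * (b * b) ≢ 0
  *-square≢0 {N} {b} N≢0 1≤b eq with m*n≡0⇒m≡0∨n≡0 N eq
  ... | inj₁ N≡0  = N≢0 N≡0
  ... | inj₂ b²≡0 = <⇒≱ 1≤b (≤-reflexive ([ id , id ]′ (m*n≡0⇒m≡0∨n≡0 b b²≡0)))

  private
    larger-by-4 : ∀ {x y} → x ≤ y → (x + y) * (x + y) ≡ 4 * (x * y) + 16 → y ≡ x + 4
    larger-by-4 {x} {y} x≤y eq with m≤n⇒∃[o]m+o≡n x≤y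
    ... | δ , refl = cong (_+_ x) (square-injective (+-cancelˡ-≡ (4 * (x * (x + δ))) _ _ (begin
      4 * (x * (x + δ)) + δ * δ       ≡⟨ solve (x ∷ δ ∷ []) ⟩
      (x + (x + δ)) * (x + (x + δ))   ≡⟨ eq ⟩
      4 * (x * (x + δ)) + 4 * 4       ∎)))
      where open ≡-Reasoning

  [x+y]²≡4xy+16⇒x≡y+4∨y≡x+4 : ∀ {x y} → (x + y) * (x + y) ≡ 4 * (x * y) + 16 → x ≡ y + 4 ⊎ y ≡ x + 4
  [x+y]²≡4xy+16⇒x≡y+4∨y≡x+4 {x} {y} eq with ≤-total x y
  ... | inj₁ x≤y = inj₂ (larger-by-4 x≤y eq)
  ... | inj₂ y≤x = inj₁ (larger-by-4 y≤x
    (trans (cong (λ z → z * z) (+-comm y x)) (trans eq (cong (λ z → 4 * z + 16) (*-comm x y)))))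

  half-difference : ∀ {x y k} → x + y ≡ 2 * k → y ≤ x → ∃[ z ] 2 * z + y ≡ x
  half-difference {x} {y} {k} x+y≡2k y≤x with m≤n⇒∃[o]m+o≡n y≤k
    where
    y≤k : y ≤ k
    y≤k = *-cancelˡ-≤ 2 (begin
      2 * y   ≡⟨ solve (y ∷ []) ⟩
      y + y   ≤⟨ +-monoˡ-≤ y y≤x ⟩
      x + y   ≡⟨ x+y≡2k ⟩
      2 * k   ∎)
      where open ≤-Reasoning
  ... | z , y+z≡k = z , +-cancelʳ-≡ y _ _ (begin
    2 * z + y + y   ≡⟨ solve (z ∷ y ∷ []) ⟩
    2 * (y + z)     ≡⟨ cong (2 *_) y+z≡k ⟩
    2 * k           ≡⟨ sym x+y≡2k ⟩
    x + y           ∎)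
    where open ≡-Reasoning

  integer-sqrt : ∀ n → ∃[ r ] r * r ≤ n × n < suc r * suc r
  integer-sqrt zero = 0 , z≤n , s≤s z≤n
  integer-sqrt (suc n) with integer-sqrt n
  ... | r , r²≤n , n<[1+r]² with suc r * suc r ≤? suc n
  ...   | no  [1+r]²≰1+n = r , m≤n⇒m≤1+n r²≤n , ≰⇒> [1+r]²≰1+n
  ...   | yes [1+r]²≤1+n = suc r , [1+r]²≤1+n ,
          subst (_< suc (suc r) * suc (suc r)) (≤-antisym [1+r]²≤1+n n<[1+r]²)
                (*-mono-< (n<1+n (suc r)) (n<1+n (suc r)))

module Norms where

  open import Data.Integer
  open import Data.Integer.Properties
  import Data.Nat.Properties as ℕ
  open import Data.Integer.Tactic.RingSolver using (solve-∀)
  open import Relation.Binary.PropositionalEquality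
  open ≡-Reasoning

  Norm : ℕ → ℤ → ℤ → ℤ
  Norm N x y = x * x - + N * (y * y)

  -- Brahmagupta's identity for ε θ̄, where ε = (x₁ + y₁ √N) / 2 and θ = (x₂ + y₂ √N) / 2.
  norm-conj : ∀ N {x₁ y₁ x₂ y₂ x y} →
              + 2 * x ≡ x₁ * x₂ - + N * (y₁ * y₂) → + 2 * y ≡ x₂ * y₁ - x₁ * y₂ →
              + 4 * Norm N x y ≡ Norm N x₁ y₁ * Norm N x₂ y₂
  norm-conj N {x₁} {y₁} {x₂} {y₂} {x} {y} 2x≡ 2y≡ = begin
    + 4 * Norm N x y                                      ≡⟨ quadruple x y (+ N) ⟩
    (+ 2 * x) * (+ 2 * x) - + N * ((+ 2 * y) * (+ 2 * y)) ≡⟨ cong₂ (λ u v → u * u - + N * (v * v)) 2x≡ 2y≡ ⟩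
    (x₁ * x₂ - + N * (y₁ * y₂)) * (x₁ * x₂ - + N * (y₁ * y₂)) - + N * ((x₂ * y₁ - x₁ * y₂) * (x₂ * y₁ - x₁ * y₂))
                                                          ≡⟨ brahmagupta x₁ y₁ x₂ y₂ (+ N) ⟩
    Norm N x₁ y₁ * Norm N x₂ y₂                           ∎
    where
    quadruple : ∀ x y n → + 4 * (x * x - n * (y * y)) ≡ (+ 2 * x) * (+ 2 * x) - n * ((+ 2 * y) * (+ 2 * y))
    quadruple = solve-∀
    brahmagupta : ∀ x₁ y₁ x₂ y₂ n →
      (x₁ * x₂ - n * (y₁ * y₂)) * (x₁ * x₂ - n * (y₁ * y₂)) - n * ((x₂ * y₁ - x₁ * y₂) * (x₂ * y₁ - x₁ * y₂))
      ≡ (x₁ * x₁ - n * (y₁ * y₁)) * (x₂ * x₂ - n * (y₂ * y₂))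
    brahmagupta = solve-∀

  pos-square : ∀ x → x * x ≡ + (∣ x ∣ ℕ.* ∣ x ∣)
  pos-square (+ n)    = sym (pos-* n n)
  pos-square -[1+ n ] = refl

  pos-*-* : ∀ x y z → + (x ℕ.* (y ℕ.* z)) ≡ + x * (+ y * + z)
  pos-*-* x y z = trans (pos-* x (y ℕ.* z)) (cong (+ x *_) (pos-* y z))

  pos-difference : ∀ {x y z} → x ℕ.+ y ≡ z → + x ≡ + z - + y
  pos-difference {x} {y} refl = sym (trans (cong (_- + y) (pos-+ x y)) (m+n-n (+ x) (+ y)))
    where
    m+n-n : ∀ m n → m + n - n ≡ m
    m+n-n = solve-∀

  pos-difference⁻¹ : ∀ {x y z} → + z - + y ≡ + x → x ℕ.+ y ≡ z
  pos-difference⁻¹ {x} {y} {z} eq = +-injective (begin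
    + (x ℕ.+ y)       ≡⟨ pos-+ x y ⟩
    + x + + y         ≡⟨ cong (_+ + y) (sym eq) ⟩
    + z - + y + + y   ≡⟨ m-n+n (+ z) (+ y) ⟩
    + z               ∎)
    where
    m-n+n : ∀ m n → m - n + n ≡ m
    m-n+n = solve-∀

  pos-half-difference : ∀ {x y z} → 2 ℕ.* x ℕ.+ y ≡ z → + 2 * + x ≡ + z - + y
  pos-half-difference {x} 2x+y≡z = trans (sym (pos-* 2 x)) (pos-difference 2x+y≡z)

  private
    norm-abs : ∀ N x y → Norm N x y ≡ + (∣ x ∣ ℕ.* ∣ x ∣) - + (N ℕ.* (∣ y ∣ ℕ.* ∣ y ∣))
    norm-abs N x y = cong₂ _-_ (pos-square x) (trans (cong (+ N *_) (pos-square y)) (sym (pos-* N _)))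

    neg-difference : ∀ m n → - (m - n) ≡ n - m
    neg-difference = solve-∀

  norm-pos : ∀ {N a b k} → a ℕ.* a ≡ N ℕ.* (b ℕ.* b) ℕ.+ k → Norm N (+ a) (+ b) ≡ + k
  norm-pos {N} {a} {b} {k} eq =
    trans (norm-abs N (+ a) (+ b)) (sym (pos-difference (trans (ℕ.+-comm k _) (sym eq))))

  norm-pos⁻¹ : ∀ {N a b k} → Norm N (+ a) (+ b) ≡ + k → a ℕ.* a ≡ N ℕ.* (b ℕ.* b) ℕ.+ k
  norm-pos⁻¹ {N} {a} {b} {k} eq =
    trans (sym (pos-difference⁻¹ (trans (sym (norm-abs N (+ a) (+ b))) eq))) (ℕ.+-comm k _)

  norm-neg : ∀ {N a b k} → a ℕ.* a ℕ.+ k ≡ N ℕ.* (b ℕ.* b) → Norm N (+ a) (+ b) ≡ - + k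
  norm-neg {N} {a} {b} {k} eq = begin
    Norm N (+ a) (+ b)                          ≡⟨ norm-abs N (+ a) (+ b) ⟩
    + (a ℕ.* a) - + (N ℕ.* (b ℕ.* b))           ≡⟨ neg-difference (+ (N ℕ.* (b ℕ.* b))) (+ (a ℕ.* a)) ⟨
    - (+ (N ℕ.* (b ℕ.* b)) - + (a ℕ.* a))       ≡⟨ cong -_ (pos-difference (trans (ℕ.+-comm k _) eq)) ⟨
    - + k                                       ∎

  norm-neg⁻¹ : ∀ {N x y k} → Norm N x y ≡ - + k → ∣ x ∣ ℕ.* ∣ x ∣ ℕ.+ k ≡ N ℕ.* (∣ y ∣ ℕ.* ∣ y ∣)
  norm-neg⁻¹ {N} {x} {y} {k} eq = trans (ℕ.+-comm _ k) (pos-difference⁻¹ (begin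
    + (N ℕ.* (∣ y ∣ ℕ.* ∣ y ∣)) - + (∣ x ∣ ℕ.* ∣ x ∣)
      ≡⟨ neg-difference (+ (∣ x ∣ ℕ.* ∣ x ∣)) (+ (N ℕ.* (∣ y ∣ ℕ.* ∣ y ∣))) ⟨
    - (+ (∣ x ∣ ℕ.* ∣ x ∣) - + (N ℕ.* (∣ y ∣ ℕ.* ∣ y ∣)))  ≡⟨ cong -_ (trans (sym (norm-abs N x y)) eq) ⟩
    - - + k                                               ≡⟨ neg-involutive (+ k) ⟩
    + k                                                   ∎))

module ReducedForms (N r : ℕ) (r²<N : r ℕ.* r ℕ.< N) (N<[1+r]² : N ℕ.< ℕ.suc r ℕ.* ℕ.suc r) where

  open import Data.Nat
  open import Data.Nat.Properties
  open import Data.Nat.DivMod using (_/_; _%_; m/n*n≤m; m≡m%n+[m/n]*n; m%n<n)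
  open import Data.Nat.Tactic.RingSolver using (solve)
  open import Data.List using (_∷_; [])
  open import Data.Fin using (Fin; toℕ; fromℕ<; combine)
  open import Data.Fin.Properties using (fromℕ<-injective; combine-injective; pigeonhole)
  open import Relation.Binary.PropositionalEquality
  open import Relation.Nullary using (yes; no; contradiction)

  -- ⟨ e , m , d ⟩ stands for the complete quotient (m + √N) / d of √N, with e d = N − m².
  record Form : Set where
    constructor ⟨_,_,_⟩
    field e m d : ℕ

  record Reduced (f : Form) : Set where
    open Form f
    field
      m≤r   : m ≤ r
      r<m+d : r < m + d
      d≤r+m : d ≤ r + m
      e≤r+r : e ≤ r + r
      norm  : e * d + m * m ≡ N

  -- The partial quotient ⌊(r + m) / d⌋; reduced forms have d ≠ 0.
  quotient : Form → ℕ
  quotient ⟨ _ , _ , zero ⟩  = 0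
  quotient ⟨ _ , m , d@(suc _) ⟩ = (r + m) / d

  next : Form → Form
  next f@(⟨ e , m , d ⟩) = ⟨ d , a * d ∸ m , e + 2 * a * m ∸ a * (a * d) ⟩
    where
    a : ℕ
    a = quotient f

  -- The next form is ⟨ d , m' , d' ⟩ with m' = a d − m and d' = e + 2 a m − a² d; below,
  -- m' and d' enter through these equations, which avoid truncated subtraction.
  module Step {e m d a : ℕ} (R : Reduced ⟨ e , m , d ⟩)
              (ad≤r+m : a * d ≤ r + m) (r+m<ad+d : r + m < a * d + d) where
    open Reduced R

    1≤a : 1 ≤ a
    1≤a = n≢0⇒n>0 λ a≡0 → <⇒≱ (subst (λ x → r + m < x * d + d) a≡0 r+m<ad+d) d≤r+m

    d≤ad : d ≤ a * d
    d≤ad = subst (_≤ a * d) (*-identityˡ d) (*-monoˡ-≤ d 1≤a)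

    m≤ad : m ≤ a * d
    m≤ad with d ≤? r
    ... | yes d≤r = <⇒≤ (+-cancelˡ-< r m (a * d) (<-≤-trans r+m<ad+d
                      (subst (a * d + d ≤_) (+-comm (a * d) r) (+-monoʳ-≤ (a * d) d≤r))))
    ... | no d≰r  = ≤-trans (≤-trans m≤r (<⇒≤ (≰⇒> d≰r))) d≤ad

    module _ {m'} (m'+m≡ad : m' + m ≡ a * d) where

      m'≤r : m' ≤ r
      m'≤r = +-cancelʳ-≤ m m' r (subst (_≤ r + m) (sym m'+m≡ad) ad≤r+m)

      r<m'+d : r < m' + d
      r<m'+d = +-cancelʳ-< m r (m' + d) (subst (r + m <_) (begin
        a * d + d       ≡⟨ cong (_+ d) (sym m'+m≡ad) ⟩
        m' + m + d      ≡⟨ solve (m' ∷ m ∷ d ∷ []) ⟩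
        m' + d + m      ∎) r+m<ad+d)
        where open ≡-Reasoning

      d≤m'+r : d ≤ m' + r
      d≤m'+r = ≤-trans d≤ad (subst (_≤ m' + r) m'+m≡ad (+-monoʳ-≤ m' m≤r))

      norm-shift : d * (e + 2 * a * m) + m' * m' ≡ N + d * (a * (a * d))
      norm-shift = begin
        d * (e + 2 * a * m) + m' * m'          ≡⟨ solve (d ∷ e ∷ a ∷ m ∷ m' ∷ []) ⟩
        e * d + 2 * m * (a * d) + m' * m'      ≡⟨ cong (λ x → e * d + 2 * m * x + m' * m') (sym m'+m≡ad) ⟩
        e * d + 2 * m * (m' + m) + m' * m'     ≡⟨ solve (e ∷ d ∷ m ∷ m' ∷ []) ⟩
        e * d + m * m + (m' + m) * (m' + m)    ≡⟨ cong₂ (λ x y → x + y * y) norm m'+m≡ad ⟩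
        N + (a * d) * (a * d)                  ≡⟨ cong (_+_ N) (solve (a ∷ d ∷ [])) ⟩
        N + d * (a * (a * d))                  ∎
        where open ≡-Reasoning

      a²d≤e+2am : a * (a * d) ≤ e + 2 * a * m
      a²d≤e+2am with a * (a * d) ≤? e + 2 * a * m
      ... | yes le = le
      ... | no gt  = contradiction (≤-<-trans (*-mono-≤ m'≤r m'≤r) r²<N) (≤⇒≯ (+-cancelʳ-≤ (d * D) N (m' * m') (begin
        N + d * D               ≤⟨ +-monoʳ-≤ N (m≤n+m (d * D) d) ⟩
        N + (d + d * D)         ≡⟨ cong (_+_ N) (sym (*-suc d D)) ⟩
        N + d * suc D           ≤⟨ +-monoʳ-≤ N (*-monoʳ-≤ d (≰⇒> gt)) ⟩
        N + d * (a * (a * d))   ≡⟨ sym norm-shift ⟩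
        d * D + m' * m'         ≡⟨ +-comm (d * D) (m' * m') ⟩
        m' * m' + d * D         ∎)))
        where
        open ≤-Reasoning
        D : ℕ
        D = e + 2 * a * m

      module _ {d'} (d'+a²d≡e+2am : d' + a * (a * d) ≡ e + 2 * a * m) where

        next-norm : d * d' + m' * m' ≡ N
        next-norm = +-cancelʳ-≡ (d * (a * (a * d))) _ _ (begin
          d * d' + m' * m' + d * (a * (a * d))  ≡⟨ solve (d ∷ d' ∷ m' ∷ a ∷ []) ⟩
          d * (d' + a * (a * d)) + m' * m'      ≡⟨ cong (λ x → d * x + m' * m') d'+a²d≡e+2am ⟩
          d * (e + 2 * a * m) + m' * m'         ≡⟨ norm-shift ⟩
          N + d * (a * (a * d))                 ∎)
          where open ≡-Reasoning

        r<m'+d' : r < m' + d'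
        r<m'+d' with r <? m' + d'
        ... | yes lt = lt
        ... | no m'+d'≮r with m≤n⇒∃[o]m+o≡n (≮⇒≥ m'+d'≮r)
        ...   | t , refl = contradiction r²<N (≤⇒≯ (begin
          N                                          ≡⟨ sym next-norm ⟩
          d * d' + m' * m'                           ≤⟨ +-monoˡ-≤ (m' * m') (*-monoˡ-≤ d' d≤m'+r) ⟩
          (m' + (m' + d' + t)) * d' + m' * m'        ≤⟨ m≤m+n _ (t * t + 2 * m' * t + d' * t) ⟩
          (m' + (m' + d' + t)) * d' + m' * m' + (t * t + 2 * m' * t + d' * t)
                                                     ≡⟨ solve (m' ∷ d' ∷ t ∷ []) ⟩
          (m' + d' + t) * (m' + d' + t)              ∎))
          where open ≤-Reasoning

        d'≤r+m' : d' ≤ r + m'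
        d'≤r+m' with d' ≤? r + m'
        ... | yes le = le
        ... | no d'≰r+m' = contradiction N<[1+r]² (≤⇒≯ (+-cancelʳ-≤ (m' * suc r) _ _ (begin
          suc r * suc r + m' * suc r         ≡⟨ solve (r ∷ m' ∷ []) ⟩
          suc r * (suc r + m')               ≤⟨ *-monoˡ-≤ (suc r + m') (subst (suc r ≤_) (+-comm m' d) r<m'+d) ⟩
          (d + m') * (suc r + m')            ≡⟨ solve (d ∷ m' ∷ r ∷ []) ⟩
          d * (suc r + m') + m' * m' + m' * suc r
                                             ≤⟨ +-monoˡ-≤ (m' * suc r) (+-monoˡ-≤ (m' * m') (*-monoʳ-≤ d (≰⇒> d'≰r+m'))) ⟩
          d * d' + m' * m' + m' * suc r      ≡⟨ cong (_+ m' * suc r) next-norm ⟩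
          N + m' * suc r                     ∎)))
          where open ≤-Reasoning

  module Next {e m d₀} (R : Reduced ⟨ e , m , suc d₀ ⟩) where
    private
      d a : ℕ
      d = suc d₀
      a = (r + m) / d

    r+m<ad+d : r + m < a * d + d
    r+m<ad+d = begin-strict
      r + m               ≡⟨ m≡m%n+[m/n]*n (r + m) d ⟩
      (r + m) % d + a * d <⟨ +-monoˡ-< (a * d) (m%n<n (r + m) d) ⟩
      d + a * d           ≡⟨ +-comm d (a * d) ⟩
      a * d + d           ∎
      where open ≤-Reasoning

    open Step {a = a} R (m/n*n≤m (r + m) d) r+m<ad+d public

    m'+m≡ad : (a * d ∸ m) + m ≡ a * d
    m'+m≡ad = m∸n+n≡m m≤ad

    d'+a²d≡e+2am : (e + 2 * a * m ∸ a * (a * d)) + a * (a * d) ≡ e + 2 * a * m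
    d'+a²d≡e+2am = m∸n+n≡m (a²d≤e+2am m'+m≡ad)

  reduced⇒d≢0 : ∀ {e m} → ¬ Reduced ⟨ e , m , 0 ⟩
  reduced⇒d≢0 {m = m} R = <⇒≱ (subst (r <_) (+-identityʳ m) r<m+d) m≤r
    where open Reduced R

  next-reduced : ∀ {f} → Reduced f → Reduced (next f)
  next-reduced {⟨ e , m , zero ⟩}  R = contradiction R reduced⇒d≢0
  next-reduced {⟨ e , m , suc _ ⟩} R = record
    { m≤r   = m'≤r m'+m≡ad
    ; r<m+d = r<m'+d' m'+m≡ad d'+a²d≡e+2am
    ; d≤r+m = d'≤r+m' m'+m≡ad d'+a²d≡e+2am
    ; e≤r+r = ≤-trans d≤r+m (+-monoʳ-≤ r m≤r)
    ; norm  = next-norm m'+m≡ad d'+a²d≡e+2am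
    }
    where
    open Reduced R
    open Next R

  next-spec : ∀ {e m d} → Reduced ⟨ e , m , d ⟩ →
    let a = quotient ⟨ e , m , d ⟩ in
    1 ≤ a × (a * d ∸ m) + m ≡ a * d × (e + 2 * a * m ∸ a * (a * d)) + a * (a * d) ≡ e + 2 * a * m
  next-spec {d = zero}  R = contradiction R reduced⇒d≢0
  next-spec {d = suc _} R = 1≤a , m'+m≡ad , d'+a²d≡e+2am
    where open Next R

  private
    residue-quotient-≤ : ∀ {m₁ m₂ n a₁ a₂ d} → n + m₁ ≡ a₁ * d → n + m₂ ≡ a₂ * d →
                         m₂ ≤ r → r < m₁ + d → a₂ ≤ a₁
    residue-quotient-≤ {m₁} {m₂} {n} {a₁} {a₂} {d} n+m₁≡a₁d n+m₂≡a₂d m₂≤r r<m₁+d with a₂ ≤? a₁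
    ... | yes a₂≤a₁ = a₂≤a₁
    ... | no a₂≰a₁  = contradiction m₂≤r (<⇒≱ (<-≤-trans r<m₁+d (+-cancelˡ-≤ n _ _ (begin
      n + (m₁ + d)   ≡⟨ solve (n ∷ m₁ ∷ d ∷ []) ⟩
      d + (n + m₁)   ≡⟨ cong (_+_ d) n+m₁≡a₁d ⟩
      suc a₁ * d     ≤⟨ *-monoˡ-≤ d (≰⇒> a₂≰a₁) ⟩
      a₂ * d         ≡⟨ sym n+m₂≡a₂d ⟩
      n + m₂         ∎))))
      where open ≤-Reasoning

  next-injective : ∀ {f₁ f₂} → Reduced f₁ → Reduced f₂ → next f₁ ≡ next f₂ → f₁ ≡ f₂
  next-injective {⟨ _ , _ , zero ⟩} R₁ _ _ = contradiction R₁ reduced⇒d≢0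
  next-injective {⟨ e₁ , m₁ , d@(suc _) ⟩} {⟨ e₂ , m₂ , d₂ ⟩} R₁ R₂ eq with cong Form.e eq
  ... | refl with next-spec R₁ | next-spec R₂
  ... | _ , m'₁+m₁≡a₁d , _ | _ , m'₂+m₂≡a₂d , _ = cong₂ (λ e m → ⟨ e , m , d ⟩) e₁≡e₂ m₁≡m₂
    where
    module R₁ = Reduced R₁
    module R₂ = Reduced R₂
    a₁ a₂ : ℕ
    a₁ = quotient ⟨ e₁ , m₁ , d ⟩
    a₂ = quotient ⟨ e₂ , m₂ , d ⟩
    n+m₂≡a₂d : (a₁ * d ∸ m₁) + m₂ ≡ a₂ * d
    n+m₂≡a₂d = trans (cong (_+ m₂) (cong Form.m eq)) m'₂+m₂≡a₂d
    a₁≡a₂ : a₁ ≡ a₂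
    a₁≡a₂ = ≤-antisym (residue-quotient-≤ n+m₂≡a₂d m'₁+m₁≡a₁d R₁.m≤r R₂.r<m+d)
                      (residue-quotient-≤ m'₁+m₁≡a₁d n+m₂≡a₂d R₂.m≤r R₁.r<m+d)
    m₁≡m₂ : m₁ ≡ m₂
    m₁≡m₂ = +-cancelˡ-≡ _ m₁ m₂ (trans m'₁+m₁≡a₁d (trans (cong (_* d) a₁≡a₂) (sym n+m₂≡a₂d)))
    e₁≡e₂ : e₁ ≡ e₂
    e₁≡e₂ = *-cancelʳ-≡ e₁ e₂ d (+-cancelʳ-≡ (m₁ * m₁) _ _
              (trans R₁.norm (sym (trans (cong (λ m → e₂ * d + m * m) m₁≡m₂) R₂.norm))))

  start : Form
  start = ⟨ 1 , r , N ∸ r * r ⟩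

  start-reduced : Reduced start
  start-reduced = record
    { m≤r   = ≤-refl
    ; r<m+d = subst (_≤ r + (N ∸ r * r)) (+-comm r 1) (+-monoʳ-≤ r 1≤N-r²)
    ; d≤r+m = +-cancelʳ-≤ (r * r) _ _ (begin
        N ∸ r * r + r * r  ≡⟨ m∸n+n≡m (<⇒≤ r²<N) ⟩
        N                  ≤⟨ ≤-pred (subst (N <_) [1+r]²≡ N<[1+r]²) ⟩
        r + r + r * r      ∎)
    ; e≤r+r = ≤-trans 1≤r (m≤m+n r r)
    ; norm  = trans (cong (_+ r * r) (*-identityˡ _)) (m∸n+n≡m (<⇒≤ r²<N))
    }
    where
    open ≤-Reasoning
    [1+r]²≡ : suc r * suc r ≡ suc (r + r + r * r)
    [1+r]²≡ = solve (r ∷ [])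
    1≤N-r² : 1 ≤ N ∸ r * r
    1≤N-r² = +-cancelʳ-≤ (r * r) 1 _ (subst (suc (r * r) ≤_) (sym (m∸n+n≡m (<⇒≤ r²<N))) r²<N)
    1≤r : 1 ≤ r
    1≤r = n≢0⇒n>0 λ r≡0 → <⇒≱ (subst (λ x → x * x < N) r≡0 r²<N)
                               (≤-pred (subst (λ x → N < suc x * suc x) r≡0 N<[1+r]²))

  orbit : ℕ → Form
  orbit zero    = start
  orbit (suc k) = next (orbit k)

  orbit-reduced : ∀ k → Reduced (orbit k)
  orbit-reduced zero    = start-reduced
  orbit-reduced (suc k) = next-reduced (orbit-reduced k)

  private
    B : ℕ
    B = suc (r + r)

    encode : ∀ {f} → Reduced f → Fin (B * (B * B))
    encode {f} R = combine (fromℕ< (s≤s e≤r+r)) (combine (fromℕ< (s≤s m≤r+r)) (fromℕ< (s≤s d≤r+r)))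
      where
      open Reduced R
      m≤r+r : Form.m f ≤ r + r
      m≤r+r = ≤-trans m≤r (m≤m+n r r)
      d≤r+r : Form.d f ≤ r + r
      d≤r+r = ≤-trans d≤r+m (+-monoʳ-≤ r m≤r)

    encode-injective : ∀ {f₁ f₂} (R₁ : Reduced f₁) (R₂ : Reduced f₂) → encode R₁ ≡ encode R₂ → f₁ ≡ f₂
    encode-injective {⟨ e₁ , m₁ , d₁ ⟩} {⟨ e₂ , m₂ , d₂ ⟩} R₁ R₂ eq
      with combine-injective _ _ _ _ eq
    ... | e≡ , rest with combine-injective _ _ _ _ rest
    ... | m≡ , d≡ with fromℕ<-injective e₁ e₂ _ _ e≡ | fromℕ<-injective m₁ m₂ _ _ m≡ | fromℕ<-injective d₁ d₂ _ _ d≡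
    ... | refl | refl | refl = refl

    rewind : ∀ i {k} → orbit i ≡ orbit (i + k) → orbit 0 ≡ orbit k
    rewind zero    eq = eq
    rewind (suc i) {k} eq = rewind i (next-injective (orbit-reduced i) (orbit-reduced (i + k)) eq)

  -- The pigeonhole principle on the finitely many reduced forms, together with
  -- the injectivity of next, makes the orbit of start purely periodic.
  returns : ∃[ p ] orbit (suc p) ≡ start
  returns with pigeonhole (n<1+n (B * (B * B))) (λ i → encode (orbit-reduced (toℕ i)))
  ... | i , j , i<j , same-code with m≤n⇒∃[o]m+o≡n i<j
  ... | p , i+1+p≡j = p , sym (rewind (toℕ i) (trans orbit-i≡orbit-j (cong orbit (sym (trans (+-suc (toℕ i) p) i+1+p≡j)))))
    where
    orbit-i≡orbit-j : orbit (toℕ i) ≡ orbit (toℕ j)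
    orbit-i≡orbit-j = encode-injective (orbit-reduced (toℕ i)) (orbit-reduced (toℕ j)) same-code

module Convergents (N r : ℕ) (r²<N : r ℕ.* r ℕ.< N) (N<[1+r]² : N ℕ.< ℕ.suc r ℕ.* ℕ.suc r) where

  open import Data.Integer
  open import Data.Integer.Properties
  import Data.Nat.Properties as ℕ
  open import Data.Integer.Tactic.RingSolver using (solve-∀)
  open import Data.Product using (proj₁; proj₂)
  open import Relation.Binary.PropositionalEquality
  open ReducedForms N r r²<N N<[1+r]²
  open Norms

  Bilinear : ℤ → ℤ → ℤ → ℤ → ℤ
  Bilinear x y x' y' = x * x' - + N * (y * y')

  -- p / q is the current convergent of √N and p' / q' the previous one.
  record Convergent : Set where
    constructor convergents
    field p q p' q' : ℕ

  advance : ℕ → Convergent → Convergent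
  advance a (convergents p q p' q') = convergents (a ℕ.* p ℕ.+ p') (a ℕ.* q ℕ.+ q') p q

  convergent : ℕ → Convergent
  convergent ℕ.zero  = convergents r 1 1 0
  convergent (ℕ.suc k) = advance (quotient (orbit k)) (convergent k)

  record Invariant (f : Form) (c : Convergent) (s : ℤ) : Set where
    open Form f
    open Convergent c
    field
      norm-pq     : Norm N (+ p) (+ q) ≡ s * + d
      bilinear    : Bilinear (+ p) (+ q) (+ p') (+ q') ≡ - (s * + m)
      norm-p'q'   : Norm N (+ p') (+ q') ≡ - (s * + e)
      1≤q         : 1 ℕ.≤ q

  pos-affine : ∀ a x y → + (a ℕ.* x ℕ.+ y) ≡ + a * + x + + y
  pos-affine a x y = trans (pos-+ (a ℕ.* x) y) (cong (_+ + y) (pos-* a x))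

  module _ {A P Q P' Q' s D M E : ℤ}
           (norm-pq : Norm N P Q ≡ s * D) (bilinear : Bilinear P Q P' Q' ≡ - (s * M))
           (norm-p'q' : Norm N P' Q' ≡ - (s * E)) where
    open ≡-Reasoning

    advance-norm : Norm N (A * P + P') (A * Q + Q') ≡ - s * (E + + 2 * A * M - A * (A * D))
    advance-norm = begin
      Norm N (A * P + P') (A * Q + Q')
        ≡⟨ expand A P Q P' Q' (+ N) ⟩
      A * A * Norm N P Q + + 2 * A * Bilinear P Q P' Q' + Norm N P' Q'
        ≡⟨ cong₂ (λ u v → A * A * u + + 2 * A * v + Norm N P' Q') norm-pq bilinear ⟩
      A * A * (s * D) + + 2 * A * - (s * M) + Norm N P' Q'
        ≡⟨ cong (λ x → A * A * (s * D) + + 2 * A * - (s * M) + x) norm-p'q' ⟩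
      A * A * (s * D) + + 2 * A * - (s * M) + - (s * E)
        ≡⟨ collect A D M E s ⟩
      - s * (E + + 2 * A * M - A * (A * D)) ∎
      where
      expand : ∀ a p q p' q' n →
        (a * p + p') * (a * p + p') - n * ((a * q + q') * (a * q + q'))
        ≡ a * a * (p * p - n * (q * q)) + + 2 * a * (p * p' - n * (q * q')) + (p' * p' - n * (q' * q'))
      expand = solve-∀
      collect : ∀ a d m e s → a * a * (s * d) + + 2 * a * - (s * m) + - (s * e) ≡ - s * (e + + 2 * a * m - a * (a * d))
      collect = solve-∀

    advance-bilinear : Bilinear (A * P + P') (A * Q + Q') P Q ≡ - (- s * (A * D - M))
    advance-bilinear = begin
      Bilinear (A * P + P') (A * Q + Q') P Q  ≡⟨ expand A P Q P' Q' (+ N) ⟩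
      A * Norm N P Q + Bilinear P Q P' Q'     ≡⟨ cong₂ (λ u v → A * u + v) norm-pq bilinear ⟩
      A * (s * D) + - (s * M)                 ≡⟨ collect A D M s ⟩
      - (- s * (A * D - M))                   ∎
      where
      expand : ∀ a p q p' q' n →
        (a * p + p') * p - n * ((a * q + q') * q) ≡ a * (p * p - n * (q * q)) + (p * p' - n * (q * q'))
      expand = solve-∀
      collect : ∀ a d m s → a * (s * d) + - (s * m) ≡ - (- s * (a * d - m))
      collect = solve-∀

  invariant-step : ∀ {f c s} → Reduced f → Invariant f c s →
                   Invariant (next f) (advance (quotient f) c) (- s)
  invariant-step {f@(⟨ e , m , d ⟩)} {convergents p q p' q'} {s} R I = record
    { norm-pq   = trans (cong₂ (Norm N) (pos-affine a p p') (pos-affine a q q'))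
                        (trans (advance-norm {A} {+ p} {+ q} {+ p'} {+ q'} {s} {+ d} {+ m} {+ e} norm-pq bilinear norm-p'q')
                               (cong (- s *_) (sym d'≡)))
    ; bilinear  = trans (cong₂ (λ u v → Bilinear u v (+ p) (+ q)) (pos-affine a p p') (pos-affine a q q'))
                        (trans (advance-bilinear {A} {+ p} {+ q} {+ p'} {+ q'} {s} {+ d} {+ m} {+ e} norm-pq bilinear norm-p'q')
                               (cong (λ x → - (- s * x)) (sym m'≡)))
    ; norm-p'q' = trans norm-pq (neg-neg s (+ d))
    ; 1≤q       = ℕ.≤-trans 1≤q (ℕ.≤-trans (ℕ.m≤n*m q a {{ℕ.>-nonZero 1≤a}}) (ℕ.m≤m+n (a ℕ.* q) q'))
    }
    where
    open Invariant I
    a m' d' : ℕ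
    a  = quotient f
    m' = a ℕ.* d ℕ.∸ m
    d' = e ℕ.+ 2 ℕ.* a ℕ.* m ℕ.∸ a ℕ.* (a ℕ.* d)
    A : ℤ
    A = + a
    1≤a : 1 ℕ.≤ a
    1≤a = proj₁ (next-spec R)
    m'≡ : + m' ≡ A * + d - + m
    m'≡ = trans (pos-difference (proj₁ (proj₂ (next-spec R)))) (cong (_- + m) (pos-* a d))
    d'≡ : + d' ≡ + e + + 2 * A * + m - A * (A * + d)
    d'≡ = trans (pos-difference (proj₂ (proj₂ (next-spec R))))
                (cong₂ _-_ (trans (pos-+ e _) (cong (_+_ (+ e)) (trans (pos-* (2 ℕ.* a) m) (cong (_* + m) (pos-* 2 a)))))
                           (trans (pos-* a (a ℕ.* d)) (cong (A *_) (pos-* a d))))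
    neg-neg : ∀ s d → s * d ≡ - (- s * d)
    neg-neg = solve-∀

  invariant-start : Invariant start (convergent 0) -1ℤ
  invariant-start = record
    { norm-pq   = trans (initial-norm (+ r) (+ N)) (cong (-1ℤ *_) (sym N-r²≡))
    ; bilinear  = initial-bilinear (+ r) (+ N)
    ; norm-p'q' = initial-previous (+ N)
    ; 1≤q       = ℕ.≤-refl
    }
    where
    N-r²≡ : + (N ℕ.∸ r ℕ.* r) ≡ + N - + r * + r
    N-r²≡ = trans (pos-difference (ℕ.m∸n+n≡m (ℕ.<⇒≤ r²<N))) (cong (_-_ (+ N)) (pos-* r r))
    initial-norm : ∀ r n → r * r - n * (1ℤ * 1ℤ) ≡ -1ℤ * (n - r * r)
    initial-norm = solve-∀
    initial-bilinear : ∀ r n → r * 1ℤ - n * (1ℤ * 0ℤ) ≡ - (-1ℤ * r)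
    initial-bilinear = solve-∀
    initial-previous : ∀ n → 1ℤ * 1ℤ - n * (0ℤ * 0ℤ) ≡ - (-1ℤ * 1ℤ)
    initial-previous = solve-∀

  Signed : ℤ → Set
  Signed s = s ≡ 1ℤ ⊎ s ≡ -1ℤ

  invariant : ∀ k → ∃[ s ] Signed s × Invariant (orbit k) (convergent k) s
  invariant ℕ.zero    = -1ℤ , inj₂ refl , invariant-start
  invariant (ℕ.suc k) = step (invariant k)
    where
    step : ∃[ s ] Signed s × Invariant (orbit k) (convergent k) s →
           ∃[ s ] Signed s × Invariant (orbit (ℕ.suc k)) (convergent (ℕ.suc k)) s
    step (s , inj₁ refl , I) = -1ℤ , inj₂ refl , invariant-step (orbit-reduced k) I
    step (s , inj₂ refl , I) = 1ℤ , inj₁ refl , invariant-step (orbit-reduced k) I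

  -- When the orbit returns to start, where e = 1, the previous convergent
  -- solves x² − N y² = ±1.
  pell-solution : ∃₂ λ x y → 1 ℕ.≤ y × (Norm N (+ x) (+ y) ≡ 1ℤ ⊎ Norm N (+ x) (+ y) ≡ -1ℤ)
  pell-solution = at-return returns
    where
    at-return : ∃[ k ] orbit (ℕ.suc k) ≡ start →
                ∃₂ λ x y → 1 ℕ.≤ y × (Norm N (+ x) (+ y) ≡ 1ℤ ⊎ Norm N (+ x) (+ y) ≡ -1ℤ)
    at-return (k , orbit≡start) = x , y , Invariant.1≤q (proj₂ (proj₂ (invariant k))) , norm±1 (invariant (ℕ.suc k))
      where
      x y : ℕ
      x = Convergent.p (convergent k)
      y = Convergent.q (convergent k)
      norm±1 : ∃[ s ] Signed s × Invariant (orbit (ℕ.suc k)) (convergent (ℕ.suc k)) s →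
               Norm N (+ x) (+ y) ≡ 1ℤ ⊎ Norm N (+ x) (+ y) ≡ -1ℤ
      norm±1 (s , ±1 , I) with ±1 | Invariant.norm-p'q' (subst (λ f → Invariant f (convergent (ℕ.suc k)) s) orbit≡start I)
      ... | inj₁ refl | x²-Ny²≡-1 = inj₂ x²-Ny²≡-1
      ... | inj₂ refl | x²-Ny²≡1  = inj₁ x²-Ny²≡1

record Obstruction (N : ℕ) : Set where
  field
    κ n              : ℕ
    2≤κ              : 2 ≤ κ
    κ-squarefree     : SquareFree κ
    1≤n              : 1 ≤ n
    κn²-4-nonsquare  : ¬ IsSquare ((+ κ) ℤ.* ((+ n) ℤ.* (+ n)) ℤ.- (+ 4))
    same-field       : SameQuadField (+ N) (((+ κ) ℤ.* (+ n)) ℤ.* ((+ κ) ℤ.* (+ n)) ℤ.- (+ 4) ℤ.* (+ κ))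

module PellDescent (N : ℕ) (sfN : SquareFree N) where

  open import Data.Nat
  open import Data.Integer using (ℤ)
  open import Data.Nat.Properties
  open import Data.Nat.Induction using (<-rec)
  open import Data.Nat.Tactic.RingSolver using (solve)
  import Data.Integer.Properties as ℤ
  import Data.Integer.Tactic.RingSolver as ℤ-Solver
  open import Data.List using (_∷_; [])
  open import Relation.Binary.PropositionalEquality
  open import Data.Nat.Divisibility using (divides)
  open import Relation.Nullary using (yes; no; contradiction)
  open Arithmetic
  open Norms

  Pell : ℕ → ℕ → Set
  Pell a b = a * a ≡ N * (b * b) + 1

  private
    N≢0 : N ≢ 0
    N≢0 = squarefree⇒≢0 sfN

    2[n+2]≢0 : ∀ n → 2 * (n + 2) ≢ 0
    2[n+2]≢0 n eq with trans (+-comm 2 n) (m+n≡0⇒m≡0 (n + 2) eq)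
    ... | ()

    -- If a = 2w² + 1, then N b² = a² − 1 = (2w)² (w² + 1).
    negative-solution : ∀ {b w} → Pell (suc (2 * (w * w))) b → 1 ≤ b → NegPellSolvable N
    negative-solution {b} {w} pell 1≤b with squarefree-ratio {b = b} sfN 2w≢0 Nb²≡
      where
      Nb²≡ : N * (b * b) ≡ (2 * w) * (2 * w) * (w * w + 1)
      Nb²≡ = +-cancelʳ-≡ 1 _ _ (begin
        N * (b * b) + 1                          ≡⟨ sym pell ⟩
        suc (2 * (w * w)) * suc (2 * (w * w))    ≡⟨ solve (w ∷ []) ⟩
        (2 * w) * (2 * w) * (w * w + 1) + 1      ∎)
        where open ≡-Reasoning
      2w≢0 : 2 * w ≢ 0
      2w≢0 2w≡0 = *-square≢0 N≢0 1≤b (trans Nb²≡ (cong (λ x → x * x * (w * w + 1)) 2w≡0))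
    ... | v , _ , w²+1≡Nv² = + w , + v , norm-neg {N} {w} {v} w²+1≡Nv²

    -- If a = 2w² − 1 = 2u + 1, then N b² = a² − 1 = (2w)² u, so u = N v² and b = 2wv.
    smaller-solution : ∀ {u b w} → Pell (suc (2 * u)) b → 1 + u ≡ w * w → 1 ≤ b →
                       ∃[ v ] Pell w v × 1 ≤ v × v < b
    smaller-solution {u} {b} {w} pell 1+u≡w² 1≤b with squarefree-ratio {b = b} sfN 2w≢0 Nb²≡
      where
      Nb²≡ : N * (b * b) ≡ (2 * w) * (2 * w) * u
      Nb²≡ = +-cancelʳ-≡ 1 _ _ (begin
        N * (b * b) + 1             ≡⟨ sym pell ⟩
        suc (2 * u) * suc (2 * u)   ≡⟨ solve (u ∷ []) ⟩
        4 * (1 + u) * u + 1         ≡⟨ cong (λ x → 4 * x * u + 1) 1+u≡w² ⟩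
        4 * (w * w) * u + 1         ≡⟨ cong (_+ 1) (solve (w ∷ u ∷ [])) ⟩
        (2 * w) * (2 * w) * u + 1   ∎)
        where open ≡-Reasoning
      2w≢0 : 2 * w ≢ 0
      2w≢0 2w≡0 = *-square≢0 N≢0 1≤b (trans Nb²≡ (cong (λ x → x * x * u) 2w≡0))
    ... | v , b≡2wv , u≡Nv² = v , w²≡Nv²+1 , 1≤v , v<b
      where
      w²≡Nv²+1 : Pell w v
      w²≡Nv²+1 = trans (sym 1+u≡w²) (trans (+-comm 1 u) (cong (_+ 1) u≡Nv²))
      1≤v : 1 ≤ v
      1≤v = n≢0⇒n>0 λ v≡0 → <⇒≱ 1≤b (≤-reflexive (trans b≡2wv (trans (cong (2 * w *_) v≡0) (*-zeroʳ (2 * w)))))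
      v<b : v < b
      v<b = subst (v <_) (sym b≡2wv) (begin-strict
        v          <⟨ m<m+n v 1≤v ⟩
        v + v      ≡⟨ solve (v ∷ []) ⟩
        2 * 1 * v  ≤⟨ *-monoˡ-≤ v (*-monoʳ-≤ 2 1≤w) ⟩
        2 * w * v  ∎)
        where
        open ≤-Reasoning
        1≤w : 1 ≤ w
        1≤w = n≢0⇒n>0 λ w≡0 → 1+n≢0 (trans 1+u≡w² (cong (λ x → x * x) w≡0))

    even-predecessor : ∀ {a' w} → a' + 2 ≡ 2 * (w * w) → ∃[ u ] a' ≡ 2 * u × 1 + u ≡ w * w
    even-predecessor {a'} {w} a'+2≡2w² with m≤n⇒∃[o]m+o≡n 1≤w²
      where
      1≤w² : 1 ≤ w * w
      1≤w² = n≢0⇒n>0 λ w²≡0 → 1+n≢0 (trans (+-comm 2 a') (trans a'+2≡2w² (cong (2 *_) w²≡0)))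
    ... | u , 1+u≡w² = u , +-cancelʳ-≡ 2 a' (2 * u) (begin
      a' + 2          ≡⟨ a'+2≡2w² ⟩
      2 * (w * w)     ≡⟨ cong (2 *_) (sym 1+u≡w²) ⟩
      2 * (1 + u)     ≡⟨ solve (u ∷ []) ⟩
      2 * u + 2       ∎) , 1+u≡w²
      where open ≡-Reasoning

    nonsquare-shift : ∀ {a' κ m} → ¬ (∃[ s ] 2 * a' ≡ s * s) → 2 * (a' + 2) ≡ κ * (m * m) →
                      ¬ IsSquare (+ κ ℤ.* (+ m ℤ.* + m) ℤ.- + 4)
    nonsquare-shift {a'} {κ} {m} ¬□2a' 2[a'+2]≡κm² (t , κm²-4≡t²) = ¬□2a' (ℤ.∣ t ∣ , ℤ.+-injective (begin
      + (2 * a')                        ≡⟨ pos-difference {2 * a'} {4} {2 * (a' + 2)} (solve (a' ∷ [])) ⟩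
      + (2 * (a' + 2)) ℤ.- + 4          ≡⟨ cong (λ x → + x ℤ.- + 4) 2[a'+2]≡κm² ⟩
      + (κ * (m * m)) ℤ.- + 4           ≡⟨ cong (ℤ._- + 4) (pos-*-* κ m m) ⟩
      + κ ℤ.* (+ m ℤ.* + m) ℤ.- + 4     ≡⟨ κm²-4≡t² ⟩
      t ℤ.* t                           ≡⟨ pos-square t ⟩
      + (ℤ.∣ t ∣ * ℤ.∣ t ∣)             ∎))
      where open ≡-Reasoning

    -- With a = 1 + a' and X = 2(a + 1) = κ m²: ((κ m)² − 4κ) m² = X² − 4X = 4(a² − 1) = N (2b)².
    same-field : ∀ {a' b κ m} → Pell (suc a') b → 1 ≤ b → m ≢ 0 → 2 * (a' + 2) ≡ κ * (m * m) →
                 SameQuadField (+ N) ((+ κ ℤ.* + m) ℤ.* (+ κ ℤ.* + m) ℤ.- + 4 ℤ.* + κ)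
    same-field {a'} {b} {κ} {m} pell 1≤b m≢0 2[a'+2]≡κm² =
      + m , + 2 ℤ.* + b , (λ m≡0 → m≢0 (ℤ.+-injective m≡0)) , 2b≢0 , (begin
        + N ℤ.* ((+ 2 ℤ.* + b) ℤ.* (+ 2 ℤ.* + b))   ≡⟨ quadruple (+ N) (+ b) ⟩
        + 4 ℤ.* (+ N ℤ.* (+ b ℤ.* + b))             ≡⟨ cong (+ 4 ℤ.*_) (sym a'[a'+2]≡Nb²) ⟩
        + 4 ℤ.* (+ a' ℤ.* (+ a' ℤ.+ + 2))           ≡⟨ complete-square (+ a') ⟩
        X ℤ.* X ℤ.- + 4 ℤ.* X                       ≡⟨ cong (λ x → x ℤ.* x ℤ.- + 4 ℤ.* x) (sym κm²≡X) ⟩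
        K[MM] ℤ.* K[MM] ℤ.- + 4 ℤ.* K[MM]           ≡⟨ factor (+ κ) (+ m) ⟩
        ((+ κ ℤ.* + m) ℤ.* (+ κ ℤ.* + m) ℤ.- + 4 ℤ.* + κ) ℤ.* (+ m ℤ.* + m) ∎)
      where
      open ≡-Reasoning
      X K[MM] : ℤ
      X = + 2 ℤ.* (+ a' ℤ.+ + 2)
      K[MM] = + κ ℤ.* (+ m ℤ.* + m)
      κm²≡X : K[MM] ≡ X
      κm²≡X = trans (sym (pos-*-* κ m m))
                (trans (cong +_ (sym 2[a'+2]≡κm²)) (trans (ℤ.pos-* 2 (a' + 2)) (cong (+ 2 ℤ.*_) (ℤ.pos-+ a' 2))))
      pell-shifted : a' * (a' + 2) ≡ N * (b * b)
      pell-shifted = +-cancelʳ-≡ 1 _ _ (begin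
        a' * (a' + 2) + 1  ≡⟨ solve (a' ∷ []) ⟩
        suc a' * suc a'    ≡⟨ pell ⟩
        N * (b * b) + 1    ∎)
      a'[a'+2]≡Nb² : + a' ℤ.* (+ a' ℤ.+ + 2) ≡ + N ℤ.* (+ b ℤ.* + b)
      a'[a'+2]≡Nb² = trans (trans (cong (+ a' ℤ.*_) (sym (ℤ.pos-+ a' 2))) (sym (ℤ.pos-* a' (a' + 2))))
                            (trans (cong +_ pell-shifted) (pos-*-* N b b))
      2b≢0 : + 2 ℤ.* + b ≢ ℤ.0ℤ
      2b≢0 2b≡0 = <⇒≱ 1≤b (≤-reflexive (*-cancelˡ-≡ b 0 2 (ℤ.+-injective (trans (ℤ.pos-* 2 b) 2b≡0))))
      quadruple : ∀ n b → n ℤ.* ((+ 2 ℤ.* b) ℤ.* (+ 2 ℤ.* b)) ≡ + 4 ℤ.* (n ℤ.* (b ℤ.* b))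
      quadruple = ℤ-Solver.solve-∀
      complete-square : ∀ a → + 4 ℤ.* (a ℤ.* (a ℤ.+ + 2))
                              ≡ (+ 2 ℤ.* (a ℤ.+ + 2)) ℤ.* (+ 2 ℤ.* (a ℤ.+ + 2)) ℤ.- + 4 ℤ.* (+ 2 ℤ.* (a ℤ.+ + 2))
      complete-square = ℤ-Solver.solve-∀
      factor : ∀ k m → (k ℤ.* (m ℤ.* m)) ℤ.* (k ℤ.* (m ℤ.* m)) ℤ.- + 4 ℤ.* (k ℤ.* (m ℤ.* m))
                       ≡ ((k ℤ.* m) ℤ.* (k ℤ.* m) ℤ.- + 4 ℤ.* k) ℤ.* (m ℤ.* m)
      factor = ℤ-Solver.solve-∀

    obstruction : ∀ {a' b κ m} → Pell (suc a') b → 1 ≤ b →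
                  ¬ (∃[ s ] 2 * a' ≡ s * s) → ¬ (∃[ s ] 2 * (a' + 2) ≡ s * s) →
                  SquareFree κ → 2 * (a' + 2) ≡ κ * (m * m) → Obstruction N
    obstruction {a'} {b} {κ} {m} pell 1≤b ¬□2a' ¬□2[a'+2] sfκ 2[a'+2]≡κm² = record
      { κ               = κ
      ; n               = m
      ; 2≤κ             = 2≤κ 2[a'+2]≡κm²
      ; κ-squarefree    = sfκ
      ; 1≤n             = n≢0⇒n>0 m≢0
      ; κn²-4-nonsquare = nonsquare-shift {a'} {κ} {m} ¬□2a' 2[a'+2]≡κm²
      ; same-field      = same-field {a'} {b} {κ} {m} pell 1≤b m≢0 2[a'+2]≡κm²
      }
      where
      2≤κ : ∀ {k} → 2 * (a' + 2) ≡ k * (m * m) → 2 ≤ k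
      2≤κ {zero}        eq = contradiction eq (2[n+2]≢0 a')
      2≤κ {suc zero}    eq = contradiction (m , trans eq (*-identityˡ (m * m))) ¬□2[a'+2]
      2≤κ {suc (suc _)} _  = s≤s (s≤s z≤n)
      m≢0 : m ≢ 0
      m≢0 refl = 2[n+2]≢0 a' (trans 2[a'+2]≡κm² (*-zeroʳ κ))

  pell-descent : ∀ b {a} → Pell a b → 1 ≤ b → NegPellSolvable N ⊎ Obstruction N
  pell-descent = <-rec (λ b → ∀ {a} → Pell a b → 1 ≤ b → NegPellSolvable N ⊎ Obstruction N) descend
    where
    descend : ∀ b → (∀ {v} → v < b → ∀ {a} → Pell a v → 1 ≤ v → NegPellSolvable N ⊎ Obstruction N) →
              ∀ {a} → Pell a b → 1 ≤ b → NegPellSolvable N ⊎ Obstruction N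
    descend b smaller {zero} pell 1≤b = contradiction (sym pell) (subst (_≢ 0) (+-comm 1 _) 1+n≢0)
    descend b smaller {suc a'} pell 1≤b with square? (2 * a') | square? (2 * (a' + 2))
    ... | yes (s , 2a'≡s²) | _ = inj₁ (negative (half-square {a'} {s} 2a'≡s²))
      where
      negative : ∃[ w ] a' ≡ 2 * (w * w) → NegPellSolvable N
      negative (w , refl) = negative-solution {b} {w} pell 1≤b
    ... | no _ | yes (s , 2[a'+2]≡s²) = recurse (half-square {a' + 2} {s} 2[a'+2]≡s²)
      where
      recurse : ∃[ w ] a' + 2 ≡ 2 * (w * w) → NegPellSolvable N ⊎ Obstruction N
      recurse (w , a'+2≡2w²) with even-predecessor {a'} {w} a'+2≡2w²
      ... | u , refl , 1+u≡w² =
        let v , pell' , 1≤v , v<b = smaller-solution {u} {b} {w} pell 1+u≡w² 1≤b in smaller v<b {w} pell' 1≤v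
    ... | no ¬□2a' | no ¬□2[a'+2] = inj₂ (obstruction-of (squarefree-part (2 * (a' + 2)) (2[n+2]≢0 a')))
      where
      obstruction-of : ∃₂ (λ κ m → SquareFree κ × 2 * (a' + 2) ≡ κ * (m * m)) → Obstruction N
      obstruction-of (κ , m , sfκ , eq) = obstruction {a'} {b} {κ} {m} pell 1≤b ¬□2a' ¬□2[a'+2] sfκ eq

  pell-solution : 2 ≤ N → ∃₂ λ x y → 1 ≤ y × (Norm N (+ x) (+ y) ≡ ℤ.1ℤ ⊎ Norm N (+ x) (+ y) ≡ ℤ.-1ℤ)
  pell-solution 2≤N =
    let r , r²≤N , N<[1+r]² = integer-sqrt N
    in Convergents.pell-solution N r (≤∧≢⇒< r²≤N (N-nonsquare r)) N<[1+r]²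
    where
    N-nonsquare : ∀ r → r * r ≢ N
    N-nonsquare r r²≡N with sfN r (divides 1 (trans (sym r²≡N) (sym (*-identityˡ (r * r)))))
    ... | refl = <⇒≱ 2≤N (≤-reflexive (sym r²≡N))

  negative-pell-or-obstruction : 2 ≤ N → NegPellSolvable N ⊎ Obstruction N
  negative-pell-or-obstruction 2≤N = from-pell (pell-solution 2≤N)
    where
    from-pell : (∃₂ λ x y → 1 ≤ y × (Norm N (+ x) (+ y) ≡ ℤ.1ℤ ⊎ Norm N (+ x) (+ y) ≡ ℤ.-1ℤ)) →
                NegPellSolvable N ⊎ Obstruction N
    from-pell (x , y , 1≤y , inj₁ x²-Ny²≡1)  = pell-descent y {x} (norm-pos⁻¹ {N} {x} {y} {1} x²-Ny²≡1) 1≤y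
    from-pell (x , y , _   , inj₂ x²-Ny²≡-1) = inj₁ (+ x , + y , x²-Ny²≡-1)

module QuadraticUnits (N : ℕ) where

  open import Data.Nat
  open import Data.Integer using (ℤ)
  open import Data.Nat.Properties
  open import Data.Nat.Divisibility
  open import Data.Nat.Induction using (<-rec)
  open import Data.Nat.Tactic.RingSolver using (solve)
  import Data.Integer.Properties as ℤ
  import Data.Integer.Tactic.RingSolver as ℤ-Solver
  open import Data.List using (_∷_; [])
  open import Data.Product using (proj₂)
  open import Relation.Binary.Definitions using (tri<; tri≈; tri>)
  open import Relation.Binary.PropositionalEquality
  open import Relation.Nullary using (contradiction)
  open Arithmetic using (square-cancel-<; square-cancel-≤; square-injective; [x+y]²≡4xy+16⇒x≡y+4∨y≡x+4; half-difference)
  open Norms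

  -- (x , y) stands for (x + y √N) / 2.
  Unit⁺ : ℕ × ℕ → Set
  Unit⁺ (x , y) = x * x ≡ N * (y * y) + 4

  Unit⁻ : ℕ × ℕ → Set
  Unit⁻ (x , y) = x * x + 4 ≡ N * (y * y)

  IsProduct : ℕ × ℕ → ℕ × ℕ → ℕ × ℕ → Set
  IsProduct (x₁ , y₁) (x₂ , y₂) (x , y) = 2 * x ≡ x₁ * x₂ + N * (y₁ * y₂) × 2 * y ≡ x₁ * y₂ + x₂ * y₁

  IsSquareOf : ℕ × ℕ → ℕ × ℕ → Set
  IsSquareOf φ ε = IsProduct φ φ ε

  -- x ≡ N y (mod 2): the condition under which products of such pairs have integer coordinates.
  Admissible : ℕ × ℕ → Set
  Admissible (x , y) = 2 ∣ x + N * y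

  private
    2∣m+2n⇒2∣m : ∀ {m n} → 2 ∣ m + 2 * n → 2 ∣ m
    2∣m+2n⇒2∣m {m} {n} 2∣m+2n = ∣m+n∣m⇒∣n (subst (2 ∣_) (+-comm m (2 * n)) 2∣m+2n) (m∣m*n n)

    2∣n²+n : ∀ n → 2 ∣ n * n + n
    2∣n²+n zero    = divides 0 refl
    2∣n²+n (suc n) = begin
      2                        ∣⟨ ∣m∣n⇒∣m+n (2∣n²+n n) (m∣m*n (suc n)) ⟩
      n * n + n + 2 * suc n    ≡⟨ solve (n ∷ []) ⟩
      suc n * suc n + suc n    ∎
      where open ∣-Reasoning

  admissible-if-norm-even : ∀ {x y} → 2 ∣ x * x + N * (y * y) → Admissible (x , y)
  admissible-if-norm-even {x} {y} 2∣x²+Ny² = ∣m+n∣m⇒∣n 2∣sum 2∣x²+Ny²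
    where
    2∣sum : 2 ∣ (x * x + N * (y * y)) + (x + N * y)
    2∣sum = begin
      2                                       ∣⟨ ∣m∣n⇒∣m+n (2∣n²+n x) (∣-trans (2∣n²+n y) (n∣m*n N)) ⟩
      (x * x + x) + N * (y * y + y)           ≡⟨ solve (x ∷ y ∷ N ∷ []) ⟩
      (x * x + N * (y * y)) + (x + N * y)     ∎
      where open ∣-Reasoning

  product-exists : ∀ {φ ψ} → Admissible φ → Admissible ψ → ∃[ χ ] IsProduct φ ψ χ
  product-exists {x₁ , y₁} {x₂ , y₂} 2∣φ 2∣ψ with 2∣re | 2∣im
    where
    2∣im : 2 ∣ x₁ * y₂ + x₂ * y₁
    2∣im = 2∣m+2n⇒2∣m {n = N * (y₁ * y₂)} (begin
      2                                             ∣⟨ ∣m∣n⇒∣m+n (∣-trans 2∣φ (m∣m*n y₂)) (∣-trans 2∣ψ (m∣m*n y₁)) ⟩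
      (x₁ + N * y₁) * y₂ + (x₂ + N * y₂) * y₁       ≡⟨ solve (x₁ ∷ y₁ ∷ x₂ ∷ y₂ ∷ N ∷ []) ⟩
      x₁ * y₂ + x₂ * y₁ + 2 * (N * (y₁ * y₂))       ∎)
      where open ∣-Reasoning
    -- N² + N is even, so x₁x₂ + N y₁y₂ ≡ (x₁ + N y₁)(x₂ + N y₂) − N (x₁y₂ + x₂y₁) (mod 2).
    2∣re : 2 ∣ x₁ * x₂ + N * (y₁ * y₂)
    2∣re = ∣m+n∣m⇒∣n {m = N * (x₁ * y₂ + x₂ * y₁) + (N * N + N) * (y₁ * y₂)} (begin
        2
          ∣⟨ ∣m∣n⇒∣m+n (∣-trans 2∣φ (m∣m*n (x₂ + N * y₂))) (m∣m*n (N * (y₁ * y₂))) ⟩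
        (x₁ + N * y₁) * (x₂ + N * y₂) + 2 * (N * (y₁ * y₂)) ≡⟨ solve (x₁ ∷ y₁ ∷ x₂ ∷ y₂ ∷ N ∷ []) ⟩
        N * (x₁ * y₂ + x₂ * y₁) + (N * N + N) * (y₁ * y₂) + (x₁ * x₂ + N * (y₁ * y₂)) ∎)
      (∣m∣n⇒∣m+n (∣-trans 2∣im (n∣m*n N)) (∣-trans (2∣n²+n N) (m∣m*n (y₁ * y₂))))
      where open ∣-Reasoning
  ... | divides x eqx | divides y eqy = (x , y) , trans (*-comm 2 x) (sym eqx) , trans (*-comm 2 y) (sym eqy)

  square-of-product : ∀ {φ η ψ ε' θ ε} → IsProduct φ η ψ → IsSquareOf φ ε' → IsSquareOf η θ →
                      IsProduct ε' θ ε → IsSquareOf ψ ε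
  square-of-product {c , d} {a₀ , b₀} {g , h} {a' , b'} {c₀ , d₀} {a , b}
                    (2g≡ , 2h≡) (2a'≡ , 2b'≡) (2c₀≡ , 2d₀≡) (2a≡ , 2b≡) = re , im
    where
    open ≡-Reasoning
    re : 2 * a ≡ g * g + N * (h * h)
    re = *-cancelˡ-≡ _ _ 4 (begin
      4 * (2 * a)                                          ≡⟨ cong (4 *_) 2a≡ ⟩
      4 * (a' * c₀ + N * (b' * d₀))                        ≡⟨ solve (a' ∷ c₀ ∷ N ∷ b' ∷ d₀ ∷ []) ⟩
      (2 * a') * (2 * c₀) + N * ((2 * b') * (2 * d₀))      ≡⟨ cong₂ (λ u v → u * v + N * ((2 * b') * (2 * d₀))) 2a'≡ 2c₀≡ ⟩
      (c * c + N * (d * d)) * (a₀ * a₀ + N * (b₀ * b₀)) + N * ((2 * b') * (2 * d₀))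
        ≡⟨ cong₂ (λ u v → (c * c + N * (d * d)) * (a₀ * a₀ + N * (b₀ * b₀)) + N * (u * v)) 2b'≡ 2d₀≡ ⟩
      (c * c + N * (d * d)) * (a₀ * a₀ + N * (b₀ * b₀)) + N * ((c * d + c * d) * (a₀ * b₀ + a₀ * b₀))
                                                           ≡⟨ solve (c ∷ d ∷ a₀ ∷ b₀ ∷ N ∷ []) ⟩
      (c * a₀ + N * (d * b₀)) * (c * a₀ + N * (d * b₀)) + N * ((c * b₀ + a₀ * d) * (c * b₀ + a₀ * d))
                                                           ≡⟨ cong₂ (λ u v → u * u + N * (v * v)) (sym 2g≡) (sym 2h≡) ⟩
      (2 * g) * (2 * g) + N * ((2 * h) * (2 * h))          ≡⟨ solve (g ∷ h ∷ N ∷ []) ⟩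
      4 * (g * g + N * (h * h))                            ∎)
    im : 2 * b ≡ g * h + g * h
    im = *-cancelˡ-≡ _ _ 4 (begin
      4 * (2 * b)                                          ≡⟨ cong (4 *_) 2b≡ ⟩
      4 * (a' * d₀ + c₀ * b')                              ≡⟨ solve (a' ∷ d₀ ∷ c₀ ∷ b' ∷ []) ⟩
      (2 * a') * (2 * d₀) + (2 * c₀) * (2 * b')            ≡⟨ cong₂ (λ u v → u * v + (2 * c₀) * (2 * b')) 2a'≡ 2d₀≡ ⟩
      (c * c + N * (d * d)) * (a₀ * b₀ + a₀ * b₀) + (2 * c₀) * (2 * b')
        ≡⟨ cong₂ (λ u v → (c * c + N * (d * d)) * (a₀ * b₀ + a₀ * b₀) + u * v) 2c₀≡ 2b'≡ ⟩
      (c * c + N * (d * d)) * (a₀ * b₀ + a₀ * b₀) + (a₀ * a₀ + N * (b₀ * b₀)) * (c * d + c * d)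
                                                           ≡⟨ solve (c ∷ d ∷ a₀ ∷ b₀ ∷ N ∷ []) ⟩
      2 * ((c * a₀ + N * (d * b₀)) * (c * b₀ + a₀ * d))    ≡⟨ cong₂ (λ u v → 2 * (u * v)) (sym 2g≡) (sym 2h≡) ⟩
      2 * ((2 * g) * (2 * h))                              ≡⟨ solve (g ∷ h ∷ []) ⟩
      4 * (g * h + g * h)                                  ∎)

  -- ε' = ε θ̄ (the two hypotheses) implies ε = ε' θ, because θ θ̄ = 1.
  conjugate-product : ∀ {a b c₀ d₀ a' b'} → Unit⁺ (c₀ , d₀) →
                      2 * a' + N * (b * d₀) ≡ a * c₀ → 2 * b' + a * d₀ ≡ b * c₀ →
                      IsProduct (a' , b') (c₀ , d₀) (a , b)
  conjugate-product {a} {b} {c₀} {d₀} {a'} {b'} θ-unit 2a'≡ 2b'≡ = re , im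
    where
    open ≡-Reasoning
    re : 2 * a ≡ a' * c₀ + N * (b' * d₀)
    re = sym (*-cancelˡ-≡ _ _ 2 (+-cancelʳ-≡ (N * (b * d₀) * c₀ + N * (a * d₀ * d₀)) _ _ (begin
      2 * (a' * c₀ + N * (b' * d₀)) + (N * (b * d₀) * c₀ + N * (a * d₀ * d₀))
                                                        ≡⟨ solve (a' ∷ c₀ ∷ N ∷ b' ∷ d₀ ∷ b ∷ a ∷ []) ⟩
      (2 * a' + N * (b * d₀)) * c₀ + N * ((2 * b' + a * d₀) * d₀)
                                                        ≡⟨ cong₂ (λ u v → u * c₀ + N * (v * d₀)) 2a'≡ 2b'≡ ⟩
      a * c₀ * c₀ + N * (b * c₀ * d₀)                   ≡⟨ solve (a ∷ c₀ ∷ N ∷ b ∷ d₀ ∷ []) ⟩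
      a * (c₀ * c₀) + N * (b * c₀ * d₀)                 ≡⟨ cong (λ u → a * u + N * (b * c₀ * d₀)) θ-unit ⟩
      a * (N * (d₀ * d₀) + 4) + N * (b * c₀ * d₀)       ≡⟨ solve (a ∷ N ∷ d₀ ∷ b ∷ c₀ ∷ []) ⟩
      2 * (2 * a) + (N * (b * d₀) * c₀ + N * (a * d₀ * d₀))                                 ∎)))
    im : 2 * b ≡ a' * d₀ + c₀ * b'
    im = sym (*-cancelˡ-≡ _ _ 2 (+-cancelʳ-≡ (N * (b * d₀) * d₀ + a * d₀ * c₀) _ _ (begin
      2 * (a' * d₀ + c₀ * b') + (N * (b * d₀) * d₀ + a * d₀ * c₀)
                                                        ≡⟨ solve (a' ∷ d₀ ∷ c₀ ∷ b' ∷ N ∷ b ∷ a ∷ []) ⟩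
      (2 * a' + N * (b * d₀)) * d₀ + (2 * b' + a * d₀) * c₀
                                                        ≡⟨ cong₂ (λ u v → u * d₀ + v * c₀) 2a'≡ 2b'≡ ⟩
      a * c₀ * d₀ + b * c₀ * c₀                         ≡⟨ solve (a ∷ c₀ ∷ d₀ ∷ b ∷ []) ⟩
      a * c₀ * d₀ + b * (c₀ * c₀)                       ≡⟨ cong (λ u → a * c₀ * d₀ + b * u) θ-unit ⟩
      a * c₀ * d₀ + b * (N * (d₀ * d₀) + 4)             ≡⟨ solve (a ∷ c₀ ∷ d₀ ∷ b ∷ N ∷ []) ⟩
      2 * (2 * b) + (N * (b * d₀) * d₀ + a * d₀ * c₀)                                 ∎)))

  module _ {a b c d : ℕ} (ε-unit : Unit⁺ (a , b)) where
    open ≤-Reasoning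

    unit-cross-≤ : Unit⁺ (c , d) → N * (b * d) ≤ a * c
    unit-cross-≤ θ-unit = square-cancel-≤ (begin
      N * (b * d) * (N * (b * d))                                       ≤⟨ m≤m+n _ _ ⟩
      N * (b * d) * (N * (b * d)) + (4 * (N * (b * b)) + 4 * (N * (d * d)) + 16)
                                                                        ≡⟨ solve (N ∷ b ∷ d ∷ []) ⟩
      (N * (b * b) + 4) * (N * (d * d) + 4)                             ≡⟨ cong₂ _*_ (sym ε-unit) (sym θ-unit) ⟩
      (a * a) * (c * c)                                                 ≡⟨ solve (a ∷ c ∷ []) ⟩
      (a * c) * (a * c)                                                 ∎)

    unit-cross-< : Unit⁺ (c , d) → d < b → a * d < b * c
    unit-cross-< θ-unit d<b = square-cancel-< (+-cancelʳ-< (4 * (b * b)) _ _ (begin-strict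
      (a * d) * (a * d) + 4 * (b * b)               ≡⟨ solve (a ∷ d ∷ b ∷ []) ⟩
      (a * a) * (d * d) + 4 * (b * b)               ≡⟨ cong (λ x → x * (d * d) + 4 * (b * b)) ε-unit ⟩
      (N * (b * b) + 4) * (d * d) + 4 * (b * b)     ≡⟨ solve (N ∷ b ∷ d ∷ []) ⟩
      (b * b) * (N * (d * d) + 4) + 4 * (d * d)     ≡⟨ cong (λ x → (b * b) * x + 4 * (d * d)) (sym θ-unit) ⟩
      (b * b) * (c * c) + 4 * (d * d)               <⟨ +-monoʳ-< ((b * b) * (c * c)) (*-monoʳ-< 4 (*-mono-< d<b d<b)) ⟩
      (b * b) * (c * c) + 4 * (b * b)               ≡⟨ solve (b ∷ c ∷ []) ⟩
      (b * c) * (b * c) + 4 * (b * b)               ∎))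

    unit-cross-bound : Unit⁺ (c , d) → 1 ≤ d → b * c < 2 * b + a * d
    unit-cross-bound θ-unit 1≤d = square-cancel-< (begin-strict
      (b * c) * (b * c)                             ≡⟨ solve (b ∷ c ∷ []) ⟩
      (b * b) * (c * c)                             ≡⟨ cong ((b * b) *_) θ-unit ⟩
      (b * b) * (N * (d * d) + 4)                   <⟨ m<m+n _ (<-≤-trans (*-monoʳ-< 4 (*-mono-< 1≤d 1≤d)) (m≤n+m _ (4 * a * b * d))) ⟩
      (b * b) * (N * (d * d) + 4) + (4 * a * b * d + 4 * (d * d))
                                                    ≡⟨ solve (b ∷ N ∷ d ∷ a ∷ []) ⟩
      4 * (b * b) + 4 * a * b * d + (N * (b * b) + 4) * (d * d)
                                                    ≡⟨ cong (λ x → 4 * (b * b) + 4 * a * b * d + x * (d * d)) (sym ε-unit) ⟩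
      4 * (b * b) + 4 * a * b * d + (a * a) * (d * d)
                                                    ≡⟨ solve (b ∷ a ∷ d ∷ []) ⟩
      (2 * b + a * d) * (2 * b + a * d)             ∎)

    mixed-cross-< : Unit⁻ (c , d) → 1 ≤ d → c * b < a * d
    mixed-cross-< η-unit 1≤d = square-cancel-< (begin-strict
      (c * b) * (c * b)                             <⟨ m<m+n _ (<-≤-trans (*-monoʳ-< 4 (*-mono-< 1≤d 1≤d)) (m≤n+m _ (4 * (b * b)))) ⟩
      (c * b) * (c * b) + (4 * (b * b) + 4 * (d * d))
                                                    ≡⟨ solve (c ∷ b ∷ d ∷ []) ⟩
      (c * c + 4) * (b * b) + 4 * (d * d)           ≡⟨ cong (λ x → x * (b * b) + 4 * (d * d)) η-unit ⟩
      N * (d * d) * (b * b) + 4 * (d * d)           ≡⟨ solve (N ∷ d ∷ b ∷ []) ⟩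
      (N * (b * b) + 4) * (d * d)                   ≡⟨ cong (_* (d * d)) (sym ε-unit) ⟩
      (a * a) * (d * d)                             ≡⟨ solve (a ∷ d ∷ []) ⟩
      (a * d) * (a * d)                             ∎)

    mixed-cross-bound : Unit⁻ (c , d) → 1 ≤ b → b < c * d → a * d < 2 * d + c * b
    mixed-cross-bound η-unit 1≤b b<cd = square-cancel-< (+-cancelʳ-< (4 * (b * b)) _ _ (begin-strict
      (a * d) * (a * d) + 4 * (b * b)               <⟨ +-monoʳ-< ((a * d) * (a * d)) (*-monoʳ-< 4 (*-monoʳ-< b {{>-nonZero 1≤b}} b<cd)) ⟩
      (a * d) * (a * d) + 4 * (b * (c * d))         ≡⟨ solve (a ∷ d ∷ b ∷ c ∷ []) ⟩
      (a * a) * (d * d) + 4 * (b * (c * d))         ≡⟨ cong (λ x → x * (d * d) + 4 * (b * (c * d))) ε-unit ⟩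
      (N * (b * b) + 4) * (d * d) + 4 * (b * (c * d))
                                                    ≡⟨ solve (N ∷ b ∷ d ∷ c ∷ []) ⟩
      4 * (d * d) + 4 * c * d * b + N * (d * d) * (b * b)
                                                    ≡⟨ cong (λ x → 4 * (d * d) + 4 * c * d * b + x * (b * b)) (sym η-unit) ⟩
      4 * (d * d) + 4 * c * d * b + (c * c + 4) * (b * b)
                                                    ≡⟨ solve (d ∷ c ∷ b ∷ []) ⟩
      (2 * d + c * b) * (2 * d + c * b) + 4 * (b * b) ∎))

  unit⁺-admissible : ∀ {a b} → Unit⁺ (a , b) → Admissible (a , b)
  unit⁺-admissible {a} {b} ε-unit = admissible-if-norm-even (divides (N * (b * b) + 2) (begin
    a * a + N * (b * b)              ≡⟨ cong (_+ N * (b * b)) ε-unit ⟩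
    N * (b * b) + 4 + N * (b * b)    ≡⟨ solve (N ∷ b ∷ []) ⟩
    (N * (b * b) + 2) * 2            ∎))
    where open ≡-Reasoning

  unit⁻-admissible : ∀ {a b} → Unit⁻ (a , b) → Admissible (a , b)
  unit⁻-admissible {a} {b} η-unit = admissible-if-norm-even (divides (a * a + 2) (begin
    a * a + N * (b * b)              ≡⟨ cong (_+_ (a * a)) (sym η-unit) ⟩
    a * a + (a * a + 4)              ≡⟨ solve (a ∷ []) ⟩
    (a * a + 2) * 2                  ∎))
    where open ≡-Reasoning

  root-admissible : ∀ {φ ε} → IsSquareOf φ ε → Admissible φ
  root-admissible {c , d} {a , _} (2a≡ , _) = admissible-if-norm-even (divides a (trans (sym 2a≡) (*-comm 2 a)))

  quotient-unit : ∀ {a b c₀ d₀ a' b'} → Unit⁺ (a , b) → Unit⁺ (c₀ , d₀) →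
                  2 * a' + N * (b * d₀) ≡ a * c₀ → 2 * b' + a * d₀ ≡ b * c₀ → Unit⁺ (a' , b')
  quotient-unit {a} {b} {c₀} {d₀} {a'} {b'} ε-unit θ-unit 2a'≡ 2b'≡ =
    norm-pos⁻¹ {N} {a'} {b'} {4} (ℤ.*-cancelˡ-≡ (+ 4) (Norm N (+ a') (+ b')) (+ 4) (begin
      + 4 ℤ.* Norm N (+ a') (+ b')
        ≡⟨ norm-conj N {+ a} {+ b} {+ c₀} {+ d₀} {+ a'} {+ b'}
             (trans (pos-half-difference {a'} {N * (b * d₀)} {a * c₀} 2a'≡) (cong₂ ℤ._-_ (ℤ.pos-* a c₀) (pos-*-* N b d₀)))
             (trans (pos-half-difference {b'} {a * d₀} {b * c₀} 2b'≡)
                    (cong₂ ℤ._-_ (trans (ℤ.pos-* b c₀) (ℤ.*-comm (+ b) (+ c₀))) (ℤ.pos-* a d₀))) ⟩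
      Norm N (+ a) (+ b) ℤ.* Norm N (+ c₀) (+ d₀)
        ≡⟨ cong₂ ℤ._*_ (norm-pos {N} {a} {b} {4} ε-unit) (norm-pos {N} {c₀} {d₀} {4} θ-unit) ⟩
      + 4 ℤ.* + 4 ∎))
    where open ≡-Reasoning

  divide-by-unit : ∀ {a b c₀ d₀} → Unit⁺ (a , b) → Unit⁺ (c₀ , d₀) → 1 ≤ d₀ → d₀ < b →
                   ∃[ ε' ] Unit⁺ ε' × IsProduct ε' (c₀ , d₀) (a , b) × proj₂ ε' < b
  divide-by-unit {a} {b} {c₀} {d₀} ε-unit θ-unit 1≤d₀ d₀<b =
    let (k₁ , k₂) , 2k₁≡ , 2k₂≡ = product-exists {a , b} {c₀ , d₀} (unit⁺-admissible ε-unit) (unit⁺-admissible θ-unit)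
        a' , 2a'≡ = half-difference {a * c₀} {N * (b * d₀)} {k₁} (sym 2k₁≡) (unit-cross-≤ {a} {b} {c₀} {d₀} ε-unit θ-unit)
        b' , 2b'≡ = half-difference {b * c₀} {a * d₀} {k₂}
                      (trans (cong (_+ a * d₀) (*-comm b c₀)) (trans (+-comm (c₀ * b) (a * d₀)) (sym 2k₂≡)))
                                    (<⇒≤ (unit-cross-< {a} {b} {c₀} {d₀} ε-unit θ-unit d₀<b))
    in (a' , b') , quotient-unit {a} {b} {c₀} {d₀} {a'} {b'} ε-unit θ-unit 2a'≡ 2b'≡ ,
       conjugate-product {a} {b} {c₀} {d₀} {a'} {b'} θ-unit 2a'≡ 2b'≡ ,
       *-cancelˡ-< 2 b' b (+-cancelʳ-< (a * d₀) (2 * b') (2 * b)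
         (subst (_< 2 * b + a * d₀) (sym 2b'≡) (unit-cross-bound {a} {b} {c₀} {d₀} ε-unit θ-unit 1≤d₀)))

  -- ε η̄ = (X + B √N) / 2 where X = k − N b b₀ may be negative.
  negative-quotient-unit : ∀ {a b a₀ b₀ k B} → Unit⁺ (a , b) → Unit⁻ (a₀ , b₀) →
                           2 * k ≡ a * a₀ + N * (b * b₀) → 2 * B + a₀ * b ≡ a * b₀ →
                           Unit⁻ (ℤ.∣ + k ℤ.- + (N * (b * b₀)) ∣ , B)
  negative-quotient-unit {a} {b} {a₀} {b₀} {k} {B} ε-unit η-unit 2k≡ 2B≡ =
    norm-neg⁻¹ {N} {X} {+ B} {4} (ℤ.*-cancelˡ-≡ (+ 4) (Norm N X (+ B)) (ℤ.- + 4) (begin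
      + 4 ℤ.* Norm N X (+ B)                        ≡⟨ norm-conj N {+ a₀} {+ b₀} {+ a} {+ b} {X} {+ B} 2X≡ 2B≡′ ⟩
      Norm N (+ a₀) (+ b₀) ℤ.* Norm N (+ a) (+ b)   ≡⟨ cong₂ ℤ._*_ (norm-neg {N} {a₀} {b₀} {4} η-unit)
                                                                    (norm-pos {N} {a} {b} {4} ε-unit) ⟩
      ℤ.- + 4 ℤ.* + 4                               ≡⟨ ℤ.*-comm (ℤ.- + 4) (+ 4) ⟩
      + 4 ℤ.* ℤ.- + 4                               ∎))
    where
    open ≡-Reasoning
    M X : ℤ
    M = + (N * (b * b₀))
    X = + k ℤ.- M
    2k≡′ : + 2 ℤ.* + k ≡ + a₀ ℤ.* + a ℤ.+ M
    2k≡′ = trans (sym (ℤ.pos-* 2 k))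
             (trans (cong +_ 2k≡) (trans (ℤ.pos-+ (a * a₀) _) (cong (ℤ._+ M) (trans (ℤ.pos-* a a₀) (ℤ.*-comm (+ a) (+ a₀))))))
    2X≡ : + 2 ℤ.* X ≡ + a₀ ℤ.* + a ℤ.- + N ℤ.* (+ b₀ ℤ.* + b)
    2X≡ = begin
      + 2 ℤ.* (+ k ℤ.- M)                     ≡⟨ halve (+ k) M ⟨
      + 2 ℤ.* + k ℤ.- M ℤ.- M                 ≡⟨ cong (λ x → x ℤ.- M ℤ.- M) 2k≡′ ⟩
      + a₀ ℤ.* + a ℤ.+ M ℤ.- M ℤ.- M          ≡⟨ cancel (+ a₀ ℤ.* + a) M ⟩
      + a₀ ℤ.* + a ℤ.- M
        ≡⟨ cong (ℤ._-_ (+ a₀ ℤ.* + a)) (trans (pos-*-* N b b₀) (cong (+ N ℤ.*_) (ℤ.*-comm (+ b) (+ b₀)))) ⟩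
      + a₀ ℤ.* + a ℤ.- + N ℤ.* (+ b₀ ℤ.* + b) ∎
      where
      halve : ∀ k m → + 2 ℤ.* k ℤ.- m ℤ.- m ≡ + 2 ℤ.* (k ℤ.- m)
      halve = ℤ-Solver.solve-∀
      cancel : ∀ x m → x ℤ.+ m ℤ.- m ℤ.- m ≡ x ℤ.- m
      cancel = ℤ-Solver.solve-∀
    2B≡′ : + 2 ℤ.* + B ≡ + a ℤ.* + b₀ ℤ.- + a₀ ℤ.* + b
    2B≡′ = trans (pos-half-difference {B} {a₀ * b} {a * b₀} 2B≡) (cong₂ ℤ._-_ (ℤ.pos-* a b₀) (ℤ.pos-* a₀ b))

  smaller-negative-unit : ∀ {a b a₀ b₀} → Unit⁺ (a , b) → Unit⁻ (a₀ , b₀) → 1 ≤ b₀ → 1 ≤ b → b < a₀ * b₀ →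
                          ∃[ η' ] Unit⁻ η' × 1 ≤ proj₂ η' × proj₂ η' < b₀
  smaller-negative-unit {a} {b} {a₀} {b₀} ε-unit η-unit 1≤b₀ 1≤b b<a₀b₀ =
    let (k₁ , k₂) , 2k₁≡ , 2k₂≡ = product-exists {a , b} {a₀ , b₀} (unit⁺-admissible ε-unit) (unit⁻-admissible η-unit)
        B , 2B≡ = half-difference {a * b₀} {a₀ * b} {k₂} (sym 2k₂≡) (<⇒≤ a₀b<ab₀)
    in (ℤ.∣ + k₁ ℤ.- + (N * (b * b₀)) ∣ , B) , negative-quotient-unit {a} {b} {a₀} {b₀} {k₁} {B} ε-unit η-unit 2k₁≡ 2B≡ ,
       n≢0⇒n>0 (λ B≡0 → <⇒≢ a₀b<ab₀ (trans (sym (cong (λ x → 2 * x + a₀ * b) B≡0)) 2B≡)) ,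
       *-cancelˡ-< 2 B b₀ (+-cancelʳ-< (a₀ * b) (2 * B) (2 * b₀)
         (subst (_< 2 * b₀ + a₀ * b) (sym 2B≡) (mixed-cross-bound {a} {b} {a₀} {b₀} ε-unit η-unit 1≤b b<a₀b₀)))
    where
    a₀b<ab₀ : a₀ * b < a * b₀
    a₀b<ab₀ = mixed-cross-< {a} {b} {a₀} {b₀} ε-unit η-unit 1≤b₀

  -- If ε = φ², then a ± 2 = (φ ± φ̄)², and φ ± φ̄ is c or d √N.
  square-root-trace : ∀ {c d a b} → IsSquareOf (c , d) (a , b) → Unit⁺ (a , b) → a + 2 ≡ c * c ⊎ a ≡ c * c + 2
  square-root-trace {c} {d} {a} {b} (2a≡ , 2b≡) ε-unit with [x+y]²≡4xy+16⇒x≡y+4∨y≡x+4 key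
    where
    open ≡-Reasoning
    b≡cd : b ≡ c * d
    b≡cd = *-cancelˡ-≡ b (c * d) 2 (trans 2b≡ (solve (c ∷ d ∷ [])))
    key : (c * c + N * (d * d)) * (c * c + N * (d * d)) ≡ 4 * (c * c * (N * (d * d))) + 16
    key = begin
      (c * c + N * (d * d)) * (c * c + N * (d * d))   ≡⟨ cong (λ x → x * x) (sym 2a≡) ⟩
      (2 * a) * (2 * a)                               ≡⟨ solve (a ∷ []) ⟩
      4 * (a * a)                                     ≡⟨ cong (4 *_) ε-unit ⟩
      4 * (N * (b * b) + 4)                           ≡⟨ cong (λ x → 4 * (N * (x * x) + 4)) b≡cd ⟩
      4 * (N * ((c * d) * (c * d)) + 4)               ≡⟨ solve (N ∷ c ∷ d ∷ []) ⟩
      4 * (c * c * (N * (d * d))) + 16                ∎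
  ... | inj₁ c²≡Nd²+4 = inj₁ (*-cancelˡ-≡ (a + 2) (c * c) 2 (begin
    2 * (a + 2)                             ≡⟨ solve (a ∷ []) ⟩
    2 * a + 4                               ≡⟨ cong (_+ 4) 2a≡ ⟩
    c * c + N * (d * d) + 4                 ≡⟨ cong (λ x → x + N * (d * d) + 4) c²≡Nd²+4 ⟩
    N * (d * d) + 4 + N * (d * d) + 4       ≡⟨ solve (N ∷ d ∷ []) ⟩
    2 * (N * (d * d) + 4)                   ≡⟨ cong (2 *_) (sym c²≡Nd²+4) ⟩
    2 * (c * c)                             ∎))
    where open ≡-Reasoning
  ... | inj₂ Nd²≡c²+4 = inj₂ (*-cancelˡ-≡ a (c * c + 2) 2 (begin
    2 * a                                   ≡⟨ 2a≡ ⟩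
    c * c + N * (d * d)                     ≡⟨ cong (_+_ (c * c)) Nd²≡c²+4 ⟩
    c * c + (c * c + 4)                     ≡⟨ solve (c ∷ []) ⟩
    2 * (c * c + 2)                         ∎))
    where open ≡-Reasoning

  module Fundamental {a₀ b₀ : ℕ} (η-unit : Unit⁻ (a₀ , b₀)) (1≤a₀ : 1 ≤ a₀) (1≤b₀ : 1 ≤ b₀)
                     (minimal : ∀ {a b} → Unit⁻ (a , b) → 1 ≤ b → b₀ ≤ b) where

    c₀ d₀ : ℕ
    c₀ = a₀ * a₀ + 2
    d₀ = a₀ * b₀

    θ-square : IsSquareOf (a₀ , b₀) (c₀ , d₀)
    θ-square = (begin
      2 * (a₀ * a₀ + 2)           ≡⟨ solve (a₀ ∷ []) ⟩
      a₀ * a₀ + (a₀ * a₀ + 4)     ≡⟨ cong (_+_ (a₀ * a₀)) η-unit ⟩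
      a₀ * a₀ + N * (b₀ * b₀)     ∎) , twice
      where
      open ≡-Reasoning
      twice : 2 * (a₀ * b₀) ≡ a₀ * b₀ + a₀ * b₀
      twice = solve (a₀ ∷ b₀ ∷ [])

    θ-unit : Unit⁺ (c₀ , d₀)
    θ-unit = begin
      (a₀ * a₀ + 2) * (a₀ * a₀ + 2)     ≡⟨ solve (a₀ ∷ []) ⟩
      a₀ * a₀ * (a₀ * a₀ + 4) + 4       ≡⟨ cong (λ x → a₀ * a₀ * x + 4) η-unit ⟩
      a₀ * a₀ * (N * (b₀ * b₀)) + 4     ≡⟨ solve (a₀ ∷ N ∷ b₀ ∷ []) ⟩
      N * ((a₀ * b₀) * (a₀ * b₀)) + 4   ∎
      where open ≡-Reasoning

    1≤d₀ : 1 ≤ d₀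
    1≤d₀ = *-mono-≤ 1≤a₀ 1≤b₀

    private
      one-is-square : ∀ {a} → Unit⁺ (a , 0) → IsSquareOf (2 , 0) (a , 0)
      one-is-square {a} ε-unit with square-injective {a} {2} (trans ε-unit (cong (_+ 4) (*-zeroʳ N)))
      ... | refl = sym (cong (_+_ 4) (*-zeroʳ N)) , refl

      square-below-θ : ∀ {a b} → Unit⁺ (a , b) → b < d₀ → ∃[ φ ] IsSquareOf φ (a , b)
      square-below-θ {a} {zero} ε-unit _ = (2 , 0) , one-is-square {a} ε-unit
      square-below-θ {a} {b@(suc _)} ε-unit b<d₀ =
        let (a' , b') , η'-unit , 1≤b' , b'<b₀ = smaller-negative-unit {a} {b} {a₀} {b₀} ε-unit η-unit 1≤b₀ (s≤s z≤n) b<d₀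
        in contradiction (minimal {a'} {b'} η'-unit 1≤b') (<⇒≱ b'<b₀)

      square-at-θ : ∀ {a} → Unit⁺ (a , d₀) → IsSquareOf (a₀ , b₀) (a , d₀)
      square-at-θ {a} ε-unit with square-injective {a} {c₀} (trans ε-unit (sym θ-unit))
      ... | refl = θ-square

    unit-is-square : ∀ b {a} → Unit⁺ (a , b) → ∃[ φ ] IsSquareOf φ (a , b)
    unit-is-square = <-rec (λ b → ∀ {a} → Unit⁺ (a , b) → ∃[ φ ] IsSquareOf φ (a , b)) descend
      where
      descend : ∀ b → (∀ {b'} → b' < b → ∀ {a} → Unit⁺ (a , b') → ∃[ φ ] IsSquareOf φ (a , b')) →
                ∀ {a} → Unit⁺ (a , b) → ∃[ φ ] IsSquareOf φ (a , b)
      descend b smaller {a} ε-unit with <-cmp b d₀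
      ... | tri< b<d₀ _ _ = square-below-θ {a} {b} ε-unit b<d₀
      ... | tri≈ _ refl _ = (a₀ , b₀) , square-at-θ {a} ε-unit
      ... | tri> _ _ d₀<b =
        let (a' , b') , ε'-unit , ε≡ε'θ , b'<b = divide-by-unit {a} {b} {c₀} {d₀} ε-unit θ-unit 1≤d₀ d₀<b
            φ , ε'≡φ² = smaller b'<b {a'} ε'-unit
            ψ , ψ≡φη = product-exists {φ} {a₀ , b₀} (root-admissible {φ} {a' , b'} ε'≡φ²) (unit⁻-admissible η-unit)
        in ψ , square-of-product {φ} {a₀ , b₀} {ψ} {a' , b'} {c₀ , d₀} {a , b} ψ≡φη ε'≡φ² θ-square ε≡ε'θ

module NegativePell (N : ℕ) (2≤N : 2 ≤ N) (sfN : SquareFree N) where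

  open import Data.Nat
  open import Data.Integer using (ℤ; -[1+_])
  open import Data.Nat.Properties
  open import Data.Nat.Tactic.RingSolver using (solve)
  import Data.Integer.Properties as ℤ
  import Data.Integer.Tactic.RingSolver as ℤ-Solver
  open import Data.List using (_∷_; [])
  open import Data.Empty using (⊥)
  open import Relation.Binary.PropositionalEquality
  open import Relation.Nullary using (Dec; yes; no; contradiction)
  open import Relation.Nullary.Decidable using (_×-dec_)
  open Arithmetic
  open Norms
  open QuadraticUnits N

  negative-unit? : ∀ b → Dec (∃[ a ] Unit⁻ (a , b))
  negative-unit? b with anyUpTo? (λ a → a * a + 4 ≟ N * (b * b)) (suc (N * (b * b)))
  ... | yes (a , _ , η-unit) = yes (a , η-unit)
  ... | no none = no λ (a , η-unit) → none (a , s≤s (bound a η-unit) , η-unit)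
    where
    bound : ∀ a → Unit⁻ (a , b) → a ≤ N * (b * b)
    bound zero    _     = z≤n
    bound (suc a) η-unit = ≤-trans (m≤m*n (suc a) (suc a)) (subst (suc a * suc a ≤_) η-unit (m≤m+n _ 4))

  private
    doubled-unit : ∀ {x y} → x * x + 1 ≡ N * (y * y) → Unit⁻ (2 * x , 2 * y) × 1 ≤ 2 * y
    doubled-unit {x} {y} x²+1≡Ny² = (begin
      (2 * x) * (2 * x) + 4    ≡⟨ solve (x ∷ []) ⟩
      4 * (x * x + 1)          ≡⟨ cong (4 *_) x²+1≡Ny² ⟩
      4 * (N * (y * y))        ≡⟨ solve (N ∷ y ∷ []) ⟩
      N * ((2 * y) * (2 * y))  ∎) , n≢0⇒n>0 2y≢0
      where
      open ≡-Reasoning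
      2y≢0 : 2 * y ≢ 0
      2y≢0 2y≡0 with m*n≡0⇒m≡0∨n≡0 2 {y} 2y≡0
      ... | inj₂ refl = 1+n≢0 (trans (+-comm 1 (x * x)) (trans x²+1≡Ny² (*-zeroʳ N)))

  minimal-negative-unit : NegPellSolvable N →
    ∃₂ λ a₀ b₀ → Unit⁻ (a₀ , b₀) × 1 ≤ b₀ × (∀ {a b} → Unit⁻ (a , b) → 1 ≤ b → b₀ ≤ b)
  minimal-negative-unit (x , y , x²-Ny²≡-1) =
    let η-unit , 1≤2∣y∣ = doubled-unit {ℤ.∣ x ∣} {ℤ.∣ y ∣} (norm-neg⁻¹ {N} {x} {y} {1} x²-Ny²≡-1)
        b₀ , (1≤b₀ , a₀ , η₀-unit) , least =
          minimal-witness (λ b → 1 ≤? b ×-dec negative-unit? b) (1≤2∣y∣ , 2 * ℤ.∣ x ∣ , η-unit)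
    in a₀ , b₀ , η₀-unit , 1≤b₀ , λ {a} η'-unit 1≤b → ≮⇒≥ λ b<b₀ → least b<b₀ (1≤b , a , η'-unit)

  positive-rational-part : ∀ {a₀ b₀} → Unit⁻ (a₀ , b₀) → 1 ≤ a₀
  positive-rational-part {zero}  {b₀} η-unit with squarefree-ratio {b = b₀} {c = 2} {w = 1} sfN (λ ()) (sym η-unit)
  ... | v , _ , 1≡Nv² = contradiction (m*n≡1⇒m≡1 N (v * v) (sym 1≡Nv²)) (λ N≡1 → <⇒≱ 2≤N (≤-reflexive N≡1))
  positive-rational-part {suc _} _ = s≤s z≤n

  same-field⇒N*square : ∀ {W} → SameQuadField (+ N) W → ∃[ t ] W ≡ + N ℤ.* (+ t ℤ.* + t)
  same-field⇒N*square {W} (p , q , p≢0 , _ , Nq²≡Wp²) =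
    let w , W≡w , NQ²≡wP² = nonnegative W Nq²≡Wp²'
        t , _ , w≡Nt² = squarefree-ratio {N} {Q} {P} {w} sfN P≢0 (trans NQ²≡wP² (*-comm w (P * P)))
    in t , trans W≡w (trans (cong +_ w≡Nt²) (pos-*-* N t t))
    where
    P Q : ℕ
    P = ℤ.∣ p ∣
    Q = ℤ.∣ q ∣
    P≢0 : P ≢ 0
    P≢0 P≡0 = p≢0 (ℤ.∣i∣≡0⇒i≡0 P≡0)
    Nq²≡Wp²' : + (N * (Q * Q)) ≡ W ℤ.* + (P * P)
    Nq²≡Wp²' = trans (trans (ℤ.pos-* N _) (cong (+ N ℤ.*_) (sym (pos-square q)))) (trans Nq²≡Wp² (cong (W ℤ.*_) (pos-square p)))
    not-negative : ∀ {m k} n → n ≢ 0 → + m ≢ -[1+ k ] ℤ.* + n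
    not-negative zero    n≢0 = contradiction refl n≢0
    not-negative (suc n) _   ()
    nonnegative : ∀ W → + (N * (Q * Q)) ≡ W ℤ.* + (P * P) → ∃[ w ] W ≡ + w × N * (Q * Q) ≡ w * (P * P)
    nonnegative (+ w)    eq = w , refl , ℤ.+-injective (trans eq (sym (ℤ.pos-* w _)))
    nonnegative -[1+ k ] eq =
      contradiction eq (not-negative {k = k} (P * P) (λ P²≡0 → P≢0 ([ id , id ]′ (m*n≡0⇒m≡0∨n≡0 P P²≡0))))

  obstruction-unit : ∀ {κ n t} → 2 ≤ κ * (n * n) →
               (+ κ ℤ.* + n) ℤ.* (+ κ ℤ.* + n) ℤ.- + 4 ℤ.* + κ ≡ + N ℤ.* (+ t ℤ.* + t) →
               Unit⁺ (κ * (n * n) ∸ 2 , n * t)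
  obstruction-unit {κ} {n} {t} 2≤κn² W≡Nt² = norm-pos⁻¹ {N} {κ * (n * n) ∸ 2} {n * t} {4} (begin
    Norm N (+ (κ * (n * n) ∸ 2)) (+ (n * t))
      ≡⟨ cong₂ (Norm N) A≡ (ℤ.pos-* n t) ⟩
    Norm N (K ℤ.* (M ℤ.* M) ℤ.- + 2) (M ℤ.* T)
      ≡⟨ pull-out K M T (+ N) ⟩
    (K ℤ.* (M ℤ.* M) ℤ.- + 2) ℤ.* (K ℤ.* (M ℤ.* M) ℤ.- + 2) ℤ.- (M ℤ.* M) ℤ.* (+ N ℤ.* (T ℤ.* T))
      ≡⟨ cong (λ x → (K ℤ.* (M ℤ.* M) ℤ.- + 2) ℤ.* (K ℤ.* (M ℤ.* M) ℤ.- + 2) ℤ.- (M ℤ.* M) ℤ.* x) (sym W≡Nt²) ⟩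
    (K ℤ.* (M ℤ.* M) ℤ.- + 2) ℤ.* (K ℤ.* (M ℤ.* M) ℤ.- + 2) ℤ.- (M ℤ.* M) ℤ.* ((K ℤ.* M) ℤ.* (K ℤ.* M) ℤ.- + 4 ℤ.* K)
      ≡⟨ cancel K M ⟩
    + 4 ∎)
    where
    open ≡-Reasoning
    K M T : ℤ
    K = + κ
    M = + n
    T = + t
    A≡ : + (κ * (n * n) ∸ 2) ≡ K ℤ.* (M ℤ.* M) ℤ.- + 2
    A≡ = trans (pos-difference (m∸n+n≡m 2≤κn²)) (cong (ℤ._- + 2) (pos-*-* κ n n))
    pull-out : ∀ k m t n → (k ℤ.* (m ℤ.* m) ℤ.- + 2) ℤ.* (k ℤ.* (m ℤ.* m) ℤ.- + 2) ℤ.- n ℤ.* ((m ℤ.* t) ℤ.* (m ℤ.* t))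
               ≡ (k ℤ.* (m ℤ.* m) ℤ.- + 2) ℤ.* (k ℤ.* (m ℤ.* m) ℤ.- + 2) ℤ.- (m ℤ.* m) ℤ.* (n ℤ.* (t ℤ.* t))
    pull-out = ℤ-Solver.solve-∀
    cancel : ∀ k m → (k ℤ.* (m ℤ.* m) ℤ.- + 2) ℤ.* (k ℤ.* (m ℤ.* m) ℤ.- + 2)
                     ℤ.- (m ℤ.* m) ℤ.* ((k ℤ.* m) ℤ.* (k ℤ.* m) ℤ.- + 4 ℤ.* k) ≡ + 4
    cancel = ℤ-Solver.solve-∀

  no-obstruction : NegPellSolvable N → ¬ Obstruction N
  no-obstruction neg obs = refute (minimal-negative-unit neg) (same-field⇒N*square same-field)
    where
    open Obstruction obs
    2≤κn² : 2 ≤ κ * (n * n)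
    2≤κn² = *-mono-≤ 2≤κ (*-mono-≤ 1≤n 1≤n)
    κn²≢square : ∀ {c} → κ * (n * n) ∸ 2 + 2 ≡ c * c → ⊥
    κn²≢square {c} A+2≡c² = <⇒≱ 2≤κ (≤-reflexive (squarefree-times-square {κ} {n} {c} κ-squarefree
      (λ n≡0 → <⇒≱ 1≤n (≤-reflexive n≡0)) (trans (sym (m∸n+n≡m 2≤κn²)) A+2≡c²)))
    κn²-4≢square : ∀ {c} → κ * (n * n) ∸ 2 ≡ c * c + 2 → ⊥
    κn²-4≢square {c} A≡c²+2 = κn²-4-nonsquare (+ c , (begin
      + κ ℤ.* (+ n ℤ.* + n) ℤ.- + 4   ≡⟨ cong (ℤ._- + 4) (sym (pos-*-* κ n n)) ⟩
      + (κ * (n * n)) ℤ.- + 4         ≡⟨ cong (λ x → + x ℤ.- + 4) κn²≡c²+4 ⟩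
      + (c * c + 4) ℤ.- + 4           ≡⟨ sym (pos-difference {c * c} {4} refl) ⟩
      + (c * c)                       ≡⟨ ℤ.pos-* c c ⟩
      + c ℤ.* + c                     ∎))
      where
      open ≡-Reasoning
      κn²≡c²+4 : κ * (n * n) ≡ c * c + 4
      κn²≡c²+4 = trans (sym (m∸n+n≡m 2≤κn²)) (trans (cong (_+ 2) A≡c²+2) (+-assoc (c * c) 2 2))
    refute : (∃₂ λ a₀ b₀ → Unit⁻ (a₀ , b₀) × 1 ≤ b₀ × (∀ {a b} → Unit⁻ (a , b) → 1 ≤ b → b₀ ≤ b)) →
                 (∃[ t ] (+ κ ℤ.* + n) ℤ.* (+ κ ℤ.* + n) ℤ.- + 4 ℤ.* + κ ≡ + N ℤ.* (+ t ℤ.* + t)) → ⊥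
    refute (a₀ , b₀ , η-unit , 1≤b₀ , minimal) (t , W≡Nt²) =
      from-root (Fundamental.unit-is-square {a₀} {b₀} η-unit (positive-rational-part {a₀} {b₀} η-unit) 1≤b₀
                   (λ {a} {b} → minimal {a} {b}) (n * t) {A} ε-unit)
      where
      A : ℕ
      A = κ * (n * n) ∸ 2
      ε-unit : Unit⁺ (A , n * t)
      ε-unit = obstruction-unit {κ} {n} {t} 2≤κn² W≡Nt²
      from-root : ∃[ φ ] IsSquareOf φ (A , n * t) → ⊥
      from-root ((c , d) , ε≡φ²) = [ κn²≢square {c} , κn²-4≢square {c} ]′ (square-root-trace {c} {d} {A} {n * t} ε≡φ² ε-unit)

corollary3p21 : (N : ℕ) → 2 ≤ N → SquareFree N →
    NegPellSolvable N ⇔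
      (∀ (κ n : ℕ) → 2 ≤ κ → SquareFree κ → 1 ≤ n →
        ¬ IsSquare ((+ κ) ℤ.* ((+ n) ℤ.* (+ n)) ℤ.- (+ 4)) →
        ¬ SameQuadField (+ N) (((+ κ) ℤ.* (+ n)) ℤ.* ((+ κ) ℤ.* (+ n)) ℤ.- (+ 4) ℤ.* (+ κ)))
corollary3p21 N 2≤N sfN = mk⇔
  (λ neg κ n 2≤κ sfκ 1≤n nonsquare same → NegativePell.no-obstruction N 2≤N sfN neg
     record { κ = κ ; n = n ; 2≤κ = 2≤κ ; κ-squarefree = sfκ ; 1≤n = 1≤n
            ; κn²-4-nonsquare = nonsquare ; same-field = same })
  (λ unobstructed → [ id , (λ obs → let open Obstruction obs in
       ⊥-elim (unobstructed κ n 2≤κ κ-squarefree 1≤n κn²-4-nonsquare same-field)) ]′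
     (PellDescent.negative-pell-or-obstruction N sfN 2≤N))
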